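{- Let $G$ be a group. Every $G$-gain graph whose underlying graph is a cycle $C_n$ is determined by its $G$-spectrum: if $(C_n,\psi)$ and a $G$-gain graph $(\Gamma',\psi')$ are $G$-cospectral, then they are switching isomorphic.
   Context: A $G$-gain graph $(\Gamma,\psi)$ is a finite simple graph $\Gamma$ with a map $\psi$ assigning to each ordered pair $(u,v)$ of adjacent vertices an element $\psi(u,v)\in G$ with $\psi(v,u)=\psi(u,v)^{ -1}$. Gain functions $\psi,\psi'$ on $\Gamma$ are switching equivalent if there is $f\colon V_\Gamma\to G$ with $\psi'(u,v)=f(u)^{ -1}\psi(u,v)f(v)$ for all adjacent $u,v$; $(\Gamma_1,\psi_1)$ and $(\Gamma_2,\psi_2)$ are switching isomorphic if there is a graph isomorphism $\phi\colon\Gamma_1\to\Gamma_2$ with $\psi_1$ switching equivalent to $\psi_2\circ\phi$, where $(\psi_2\circ\phi)(u,v)=\psi_2(\phi(u),\phi(v))$. With vertices ordered $v_1,\dots,v_n$, the adjacency matrix $A_{(\Gamma,\psi)}\in M_n(\mathbb CG)$ (entries in the group algebra) has $(i,j)$ entry $\psi(v_i,v_j)$ if $v_i\sim v_j$ and $0$ otherwise. $Tr(A)=\sum_iA_{i,i}\in\mathbb CG$. The map $\mu$ sends $\sum_xa_xx$ to the class function $g\mapsto\sum_{x\in[g]}a_x$, $[g]$ the conjugacy class of $g$. Two gain graphs on $n$ vertices with adjacency matrices $A,B$ are $G$-cospectral if $\mu(Tr(A^h))=\mu(Tr(B^h))$ for all $h\in\mathbb N$. -}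

module Defs where

open import Level using (Level; _⊔_)
open import Data.Nat using (ℕ; zero; suc; _+_; _%_)
open import Data.Bool using (Bool; true; false; if_then_else_; _∨_)
open import Data.Fin using (Fin; toℕ)
import Data.Fin as F
import Data.Nat as ℕ
open import Data.List using (List; []; _∷_; concatMap; allFin)
open import Data.Product using (∃; _×_; _,_)
open import Relation.Nullary.Decidable using (⌊_⌋)
open import Relation.Binary.PropositionalEquality using (_≡_)
open import Function.Bundles using (Bijection; _⤖_)
open import Algebra.Bundles using (Group)
open import Data.List.Relation.Binary.Permutation.Homogeneous using (Permutation)

Adjacency : ℕ → Set
Adjacency n = Fin n → Fin n → Bool

record IsSimpleGraph {n : ℕ} (adj : Adjacency n) : Set where
  field
    adj-sym : ∀ i j → adj i j ≡ adj j i
    irrefl  : ∀ i → adj i i ≡ false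

record GraphIso {n : ℕ} (adj₁ adj₂ : Adjacency n) : Set where
  field
    φ         : Fin n ⤖ Fin n
    preserves : ∀ u v → adj₁ u v ≡ adj₂ (Bijection.to φ u) (Bijection.to φ v)

-- The cycle C_n on vertices 0,…,n-1: i ~ j iff j ≡ i+1 (mod n) or i ≡ j+1 (mod n).
-- (Used only for n ≥ 3, where it is a simple graph.)
cycleAdj : (n : ℕ) → Adjacency n
cycleAdj zero i j = false
cycleAdj n@(suc _) i j =
  ⌊ toℕ j ℕ.≟ (suc (toℕ i) % n) ⌋ ∨ ⌊ toℕ i ℕ.≟ (suc (toℕ j) % n) ⌋

module _ {c ℓ : Level} (G : Group c ℓ) where
  open Group G renaming (Carrier to Elt)

  -- A G-gain graph on Fin n: a finite simple graph together with a gain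
  -- function ψ (its values on non-adjacent pairs are irrelevant) satisfying
  -- ψ(v,u) = ψ(u,v)⁻¹ for adjacent u, v.
  record GainGraph (n : ℕ) : Set (c ⊔ ℓ) where
    field
      adj    : Adjacency n
      simple : IsSimpleGraph adj
      ψ      : Fin n → Fin n → Elt
      ψ-inv  : ∀ u v → adj u v ≡ true → ψ v u ≈ ψ u v ⁻¹

  open GainGraph public

  SwitchingEquivalent : {n : ℕ} → Adjacency n → (ψ₁ ψ₂ : Fin n → Fin n → Elt) → Set (c ⊔ ℓ)
  SwitchingEquivalent adj ψ₁ ψ₂ =
    ∃ λ (f : Fin _ → Elt) → ∀ u v → adj u v ≡ true → ψ₂ u v ≈ (f u ⁻¹ ∙ ψ₁ u v) ∙ f v

  SwitchingIsomorphic : {n : ℕ} → GainGraph n → GainGraph n → Set (c ⊔ ℓ)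
  SwitchingIsomorphic Γ₁ Γ₂ =
    ∃ λ (iso : GraphIso (adj Γ₁) (adj Γ₂)) →
      let φ = Bijection.to (GraphIso.φ iso) in
      SwitchingEquivalent (adj Γ₁) (ψ Γ₁) (λ u v → ψ Γ₂ (φ u) (φ v))

  -- The group semiring ℕG, with an element Σ_x a_x x (a_x ∈ ℕ) represented
  -- by a list in which each x occurs a_x times (lists are taken up to
  -- permutation, which is all that matters below).

  ℕG : Set c
  ℕG = List Elt

  _⊕_ : ℕG → ℕG → ℕG
  _⊕_ = Data.List._++_

  _⊗_ : ℕG → ℕG → ℕG
  a ⊗ b = concatMap (λ x → Data.List.map (λ y → x ∙ y) b) a

  Mat : ℕ → Set c
  Mat n = Fin n → Fin n → ℕG

  adjMat : {n : ℕ} → GainGraph n → Mat n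
  adjMat Γ i j = if adj Γ i j then ψ Γ i j ∷ [] else []

  idMat : {n : ℕ} → Mat n
  idMat i j = if ⌊ i F.≟ j ⌋ then ε ∷ [] else []

  _·_ : {n : ℕ} → Mat n → Mat n → Mat n
  (A · B) i j = concatMap (λ k → A i k ⊗ B k j) (allFin _)

  _^ᴹ_ : {n : ℕ} → Mat n → ℕ → Mat n
  A ^ᴹ zero  = idMat
  A ^ᴹ suc h = A · (A ^ᴹ h)

  Tr : {n : ℕ} → Mat n → ℕG
  Tr A = concatMap (λ i → A i i) (allFin _)

  _∼conj_ : Elt → Elt → Set (c ⊔ ℓ)
  x ∼conj y = ∃ λ g → (g ∙ x) ∙ g ⁻¹ ≈ y

  -- μ a = μ b as class functions: for ℕ-coefficients this says exactly that
  -- a and b contain the same number of elements from each conjugacy class,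
  -- i.e. the lists are permutations of each other up to conjugacy.
  SameClassFunction : ℕG → ℕG → Set (c ⊔ ℓ)
  SameClassFunction a b = Permutation _∼conj_ a b

  Cospectral : {n : ℕ} → GainGraph n → GainGraph n → Set (c ⊔ ℓ)
  Cospectral Γ₁ Γ₂ =
    ∀ (h : ℕ) → SameClassFunction (Tr (adjMat Γ₁ ^ᴹ h)) (Tr (adjMat Γ₂ ^ᴹ h))

module Submission where

-- The length of tr Aʰ counts the closed walks of length h in the underlying graph, so Γ′
-- has exactly as many closed walks of each length h < n as C_n. The counts for h = 2, 3, 4
-- force every degree of Γ′ to be 2, and a 2-regular graph with no surplus short closed
-- walks has no cycle shorter than n, so Γ′ is an n-cycle as well. On an n-cycle with
-- cycle gain g, a closed walk of length n either does not wind (gain ε) or winds once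
-- (gain conjugate to g or g⁻¹), and g itself occurs; matching the conjugacy classes of
-- tr Aⁿ gives g′ ∼ g or g′ ∼ g⁻¹. Orienting Γ′ accordingly, the partial products of the
-- gains along the two cycles (their potentials) yield the switching function.

open import Defs
open import Level using (Level)
open import Data.Nat using (ℕ; _+_)
open import Algebra.Bundles using (Group)
open import Data.Sum using (_⊎_; inj₁; inj₂)
open import Relation.Binary.PropositionalEquality as ≡ using (_≡_)

module KroneckerSums where

  open import Data.Nat
  open import Data.Nat.Properties
  open import Data.Fin as F using (Fin; zero; suc)
  open import Data.Bool using (Bool; true; false)
  open import Relation.Nullary using (¬_; Dec; yes; no)
  open import Relation.Nullary.Decidable using (⌊_⌋)
  open import Relation.Binary.PropositionalEquality
  open import Data.Empty using (⊥-elim)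
  open import Function using (_∘_)
  open import Algebra.Properties.Semiring.Sum +-*-semiring public
    using (sum; sum-syntax; sum-cong-≗; ∑-distrib-+; ∑-comm; *-distribˡ-sum; *-distribʳ-sum)

  𝟙 : Bool → ℕ
  𝟙 true  = 1
  𝟙 false = 0

  𝟙-yes : ∀ {p} {P : Set p} (d : Dec P) → P → 𝟙 ⌊ d ⌋ ≡ 1
  𝟙-yes (yes _) _ = refl
  𝟙-yes (no ¬p) p = ⊥-elim (¬p p)

  𝟙-no : ∀ {p} {P : Set p} (d : Dec P) → ¬ P → 𝟙 ⌊ d ⌋ ≡ 0
  𝟙-no (yes p) ¬p = ⊥-elim (¬p p)
  𝟙-no (no _)  _  = refl

  δ : ∀ {n} → Fin n → Fin n → ℕ
  δ i j = 𝟙 ⌊ i F.≟ j ⌋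

  δℕ : ℕ → ℕ → ℕ
  δℕ a b = 𝟙 ⌊ a ≟ b ⌋

  δ-refl : ∀ {n} (i : Fin n) → δ i i ≡ 1
  δ-refl i = 𝟙-yes (i F.≟ i) refl

  δ-≢ : ∀ {n} {i j : Fin n} → i ≢ j → δ i j ≡ 0
  δ-≢ {i = i} {j} = 𝟙-no (i F.≟ j)

  δℕ-refl : ∀ a → δℕ a a ≡ 1
  δℕ-refl a = 𝟙-yes (a ≟ a) refl

  δℕ-≢ : ∀ {a b} → a ≢ b → δℕ a b ≡ 0
  δℕ-≢ {a} {b} = 𝟙-no (a ≟ b)

  δ-sym : ∀ {n} (i j : Fin n) → δ i j ≡ δ j i
  δ-sym i j with i F.≟ j
  ... | yes refl = sym (δ-refl i)
  ... | no i≢j = sym (δ-≢ (i≢j ∘ sym))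

  δℕ-sym : ∀ a b → δℕ a b ≡ δℕ b a
  δℕ-sym a b with a ≟ b
  ... | yes refl = sym (δℕ-refl a)
  ... | no a≢b = sym (δℕ-≢ (a≢b ∘ sym))

  δℕ-suc : ∀ a b → δℕ (suc a) (suc b) ≡ δℕ a b
  δℕ-suc a b with a ≟ b
  ... | yes refl = δℕ-refl (suc a)
  ... | no a≢b = δℕ-≢ (a≢b ∘ suc-injective)

  δ-suc : ∀ {n} (i j : Fin n) → δ (suc i) (suc j) ≡ δ i j
  δ-suc i j with i F.≟ j
  ... | yes _ = refl
  ... | no _ = refl

  sum-δ : ∀ {n} (j : Fin n) (f : Fin n → ℕ) → ∑[ k < n ] (δ k j * f k) ≡ f j
  sum-δ {suc n} zero f = begin
    1 * f zero + ∑[ k < n ] (δ (suc k) zero * f (suc k))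
      ≡⟨ cong (1 * f zero +_) (sum-zero (λ k → cong (_* f (suc k)) (δ-≢ {i = suc k} {zero} λ ()))) ⟩
    1 * f zero + 0  ≡⟨ trans (+-identityʳ _) (*-identityˡ _) ⟩
    f zero          ∎
    where
    open ≡-Reasoning
    sum-zero : ∀ {m} {g : Fin m → ℕ} → (∀ k → g k ≡ 0) → sum g ≡ 0
    sum-zero {zero} _ = refl
    sum-zero {suc m} g≡0 = cong₂ _+_ (g≡0 zero) (sum-zero (g≡0 ∘ suc))
  sum-δ {suc n} (suc j) f = begin
    δ zero (suc j) * f zero + ∑[ k < n ] (δ (suc k) (suc j) * f (suc k))
      ≡⟨ cong₂ _+_ (cong (_* f zero) (δ-≢ {i = zero} {suc j} λ ())) (sum-cong-≗ λ k → cong (_* f (suc k)) (δ-suc k j)) ⟩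
    ∑[ k < n ] (δ k j * f (suc k))  ≡⟨ sum-δ j (f ∘ suc) ⟩
    f (suc j)                     ∎
    where open ≡-Reasoning

  sum-δ≡1 : ∀ {n} (j : Fin n) → ∑[ k < n ] δ k j ≡ 1
  sum-δ≡1 {n} j = trans (sum-cong-≗ λ k → sym (*-identityʳ (δ k j))) (sum-δ j (λ _ → 1))

  sum-mono : ∀ {n} {f g : Fin n → ℕ} → (∀ i → f i ≤ g i) → sum f ≤ sum g
  sum-mono {zero}  _   = z≤n
  sum-mono {suc n} f≤g = +-mono-≤ (f≤g zero) (sum-mono (f≤g ∘ suc))

  sum-const : ∀ n c → ∑[ i < n ] c ≡ n * c
  sum-const zero    c = refl
  sum-const (suc n) c = cong (c +_) (sum-const n c)

module WalkCounts where

  open import Data.Nat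
  open import Data.Fin as F using (Fin)
  open import Data.Bool using (true; false)
  open import Data.List using (List; []; _∷_; length; concatMap; allFin; tabulate; map)
  open import Data.List.Properties using (length-++; length-map)
  open import Relation.Nullary.Decidable using (⌊_⌋)
  open import Relation.Binary.PropositionalEquality
  open import Function using (_∘_)
  open KroneckerSums

  walks : ∀ {n} → Adjacency n → ℕ → Fin n → Fin n → ℕ
  walks         adj zero    i j = δ i j
  walks {n = n} adj (suc h) i j = ∑[ k < n ] (𝟙 (adj i k) * walks adj h k j)

  closedWalks : ∀ {n} → Adjacency n → ℕ → ℕ
  closedWalks {n} adj h = ∑[ i < n ] walks adj h i i

  length-concatMap-allFin : ∀ {a} {A : Set a} {n} (f : Fin n → List A) →
    length (concatMap f (allFin n)) ≡ ∑[ i < n ] length (f i)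
  length-concatMap-allFin {n = n} f = go (λ i → i)
    where
    go : ∀ {m} (g : Fin m → Fin n) → length (concatMap f (tabulate g)) ≡ ∑[ i < m ] length (f (g i))
    go {zero}  g = refl
    go {suc m} g = trans (length-++ (f (g F.zero))) (cong (length (f (g F.zero)) +_) (go (g ∘ F.suc)))

  module _ {c ℓ : Level} (G : Group c ℓ) where
    open Group G using (_∙_)

    length-⊗ : (a b : ℕG G) → length (_⊗_ G a b) ≡ length a * length b
    length-⊗ []      b = refl
    length-⊗ (x ∷ a) b = trans (length-++ (map (x ∙_) b)) (cong₂ _+_ (length-map _ b) (length-⊗ a b))

    length-adjMat : ∀ {n} (Γ : GainGraph G n) i j → length (adjMat G Γ i j) ≡ 𝟙 (adj Γ i j)
    length-adjMat Γ i j with adj Γ i j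
    ... | true  = refl
    ... | false = refl

    length-idMat : ∀ {n} (i j : Fin n) → length (idMat G i j) ≡ δ i j
    length-idMat i j with ⌊ i F.≟ j ⌋
    ... | true  = refl
    ... | false = refl

    length-power : ∀ {n} (Γ : GainGraph G n) h i j → length ((_^ᴹ_ G (adjMat G Γ) h) i j) ≡ walks (adj Γ) h i j
    length-power Γ zero    i j = length-idMat i j
    length-power Γ (suc h) i j =
      trans (length-concatMap-allFin (λ k → _⊗_ G (adjMat G Γ i k) (_^ᴹ_ G (adjMat G Γ) h k j)))
            (sum-cong-≗ λ k → trans (length-⊗ (adjMat G Γ i k) _) (cong₂ _*_ (length-adjMat Γ i k) (length-power Γ h k j)))

    length-trace : ∀ {n} (Γ : GainGraph G n) h → length (Tr G (_^ᴹ_ G (adjMat G Γ) h)) ≡ closedWalks (adj Γ) h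
    length-trace Γ h =
      trans (length-concatMap-allFin (λ i → (_^ᴹ_ G (adjMat G Γ) h) i i)) (sum-cong-≗ λ i → length-power Γ h i i)

module LineWalks where

  open import Data.Nat
  open import Data.Nat.Properties
  open import Data.Sum using (inj₁; inj₂)
  open import Relation.Nullary using (yes; no)
  open import Relation.Binary.PropositionalEquality
  open import Algebra.Properties.CommutativeSemigroup +-commutativeSemigroup using (interchange)
  open KroneckerSums

  -- Number of walks of length h from a to b on the path 0 — 1 — 2 — ⋯ ; the junk
  -- value 0 ∸ 1 = 0 is harmless because every use has h ≤ a.
  lineWalks : ℕ → ℕ → ℕ → ℕ
  lineWalks zero    a b = δℕ a b
  lineWalks (suc h) a b = lineWalks h (suc a) b + lineWalks h (a ∸ 1) b

  lineWalks-shift : ∀ h a b → h ≤ a → lineWalks h (suc a) (suc b) ≡ lineWalks h a b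
  lineWalks-shift zero    a       b _         = δℕ-suc a b
  lineWalks-shift (suc h) (suc a) b (s≤s h≤a) =
    cong₂ _+_ (lineWalks-shift h (suc (suc a)) b (m≤n⇒m≤1+n (m≤n⇒m≤1+n h≤a))) (lineWalks-shift h a b h≤a)

  lineWalks-diag : ∀ h a → h ≤ a → lineWalks h a a ≡ lineWalks h h h
  lineWalks-diag h a h≤a with m≤n⇒m<n∨m≡n h≤a
  ... | inj₂ refl = refl
  ... | inj₁ h<a with a
  ...   | suc a′ = trans (lineWalks-shift h a′ a′ (≤-pred h<a)) (lineWalks-diag h a′ (≤-pred h<a))

  lineWalks-out-of-reachʳ : ∀ h a b → a + h < b → lineWalks h a b ≡ 0
  lineWalks-out-of-reachʳ zero    a b p = δℕ-≢ (λ e → <⇒≢ p (trans (+-identityʳ a) e))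
  lineWalks-out-of-reachʳ (suc h) a b p = cong₂ _+_
    (lineWalks-out-of-reachʳ h (suc a) b (subst (_< b) (+-suc a h) p))
    (lineWalks-out-of-reachʳ h (a ∸ 1) b (≤-<-trans (+-monoˡ-≤ h (m∸n≤m a 1)) (≤-<-trans (+-monoʳ-≤ a (n≤1+n h)) p)))

  lineWalks-out-of-reachˡ : ∀ h a b → b + h < a → lineWalks h a b ≡ 0
  lineWalks-out-of-reachˡ zero    a       b p = δℕ-≢ (λ e → <⇒≢ p (trans (+-identityʳ b) (sym e)))
  lineWalks-out-of-reachˡ (suc h) (suc a) b p = cong₂ _+_
    (lineWalks-out-of-reachˡ h (suc (suc a)) b (m<n⇒m<1+n (m<n⇒m<1+n b+h<a)))
    (lineWalks-out-of-reachˡ h a b b+h<a)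
    where
    b+h<a : b + h < a
    b+h<a = ≤-pred (subst (_< suc a) (+-suc b h) p)

  lineWalks-descend : ∀ h b → 1 ≤ lineWalks h (b + h) b
  lineWalks-descend zero    b = ≤-reflexive (sym (trans (cong (λ x → δℕ x b) (+-identityʳ b)) (δℕ-refl b)))
  lineWalks-descend (suc h) b =
    ≤-trans (subst (λ x → 1 ≤ lineWalks h x b) (sym (cong (_∸ 1) (+-suc b h))) (lineWalks-descend h b)) (m≤n+m _ _)

  sumTo : ℕ → (ℕ → ℕ) → ℕ
  sumTo zero    f = 0
  sumTo (suc R) f = sumTo R f + f R

  sumTo-cong : ∀ R {f g : ℕ → ℕ} → (∀ i → f i ≡ g i) → sumTo R f ≡ sumTo R g
  sumTo-cong zero    _   = refl
  sumTo-cong (suc R) f≡g = cong₂ _+_ (sumTo-cong R f≡g) (f≡g R)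

  sumTo-mono : ∀ R {f g : ℕ → ℕ} → (∀ i → f i ≤ g i) → sumTo R f ≤ sumTo R g
  sumTo-mono zero    _   = z≤n
  sumTo-mono (suc R) f≤g = +-mono-≤ (sumTo-mono R f≤g) (f≤g R)

  sumTo-+ : ∀ R (f g : ℕ → ℕ) → sumTo R (λ i → f i + g i) ≡ sumTo R f + sumTo R g
  sumTo-+ zero    f g = refl
  sumTo-+ (suc R) f g = trans (cong (_+ (f R + g R)) (sumTo-+ R f g)) (interchange (sumTo R f) (sumTo R g) (f R) (g R))

  sumTo-δ : ∀ R a (f : ℕ → ℕ) → a < R → sumTo R (λ b → f b * δℕ b a) ≡ f a
  sumTo-δ (suc R) a f a<R with a ≟ R
  ... | yes refl = trans (cong₂ _+_ (vanish a λ i i<a → trans (cong (f i *_) (δℕ-≢ λ e → <-irrefl e i<a)) (*-zeroʳ (f i))) (cong (f a *_) (δℕ-refl a))) (*-identityʳ (f a))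
    where
    vanish : ∀ R {g : ℕ → ℕ} → (∀ i → i < R → g i ≡ 0) → sumTo R g ≡ 0
    vanish zero    _ = refl
    vanish (suc R) g≡0 = cong₂ _+_ (vanish R λ i i<R → g≡0 i (m<n⇒m<1+n i<R)) (g≡0 R ≤-refl)
  ... | no a≢R = trans (cong₂ _+_ (sumTo-δ R a f (≤∧≢⇒< (≤-pred a<R) a≢R)) (trans (cong (f R *_) (δℕ-≢ λ e → a≢R (sym e))) (*-zeroʳ (f R)))) (+-identityʳ (f a))

module Unrollings where

  open import Data.Nat
  open import Data.Nat.Properties
  open import Data.Fin using (Fin)
  open import Data.Bool using (true; false)
  open import Relation.Nullary using (yes; no)
  open import Relation.Binary.PropositionalEquality
  open import Data.Empty using (⊥-elim)
  open import Function using (_∘_)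
  open KroneckerSums
  open WalkCounts using (walks)
  open LineWalks

  -- p unrolls a walk of a graph in which every p (suc a) has exactly the two
  -- neighbours p a and p (suc (suc a)), so walks from p a lift to the line ℕ.
  record Unrolling {n} (adj : Adjacency n) (p : ℕ → Fin n) : Set where
    field
      forward      : ∀ a → adj (p a) (p (suc a)) ≡ true
      backward     : ∀ a → adj (p (suc a)) (p a) ≡ true
      neighbours   : ∀ a k → adj (p (suc a)) k ≡ true → k ≡ p (suc (suc a)) ⊎ k ≡ p a
      no-backtrack : ∀ a → p (suc (suc a)) ≢ p a

  sum-two-neighbours : ∀ {n} (adj : Adjacency n) x y z → adj x y ≡ true → adj x z ≡ true → y ≢ z →
    (∀ k → adj x k ≡ true → k ≡ y ⊎ k ≡ z) → (f : Fin n → ℕ) → ∑[ k < n ] (𝟙 (adj x k) * f k) ≡ f y + f z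
  sum-two-neighbours {n} adj x y z xy xz y≢z only f = begin
    ∑[ k < n ] (𝟙 (adj x k) * f k)                ≡⟨ sum-cong-≗ (λ k → trans (cong (_* f k) (split k)) (*-distribʳ-+ (f k) (δ k y) (δ k z))) ⟩
    ∑[ k < n ] (δ k y * f k + δ k z * f k)        ≡⟨ ∑-distrib-+ (λ k → δ k y * f k) (λ k → δ k z * f k) ⟩
    ∑[ k < n ] (δ k y * f k) + ∑[ k < n ] (δ k z * f k)  ≡⟨ cong₂ _+_ (sum-δ y f) (sum-δ z f) ⟩
    f y + f z                                     ∎
    where
    open ≡-Reasoning
    split : ∀ k → 𝟙 (adj x k) ≡ δ k y + δ k z
    split k with adj x k in xk
    ... | true with only k xk
    ...   | inj₁ refl = cong₂ _+_ (sym (δ-refl k)) (sym (δ-≢ y≢z))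
    ...   | inj₂ refl = cong₂ _+_ (sym (δ-≢ (y≢z ∘ sym))) (sym (δ-refl k))
    split k | false = sym (cong₂ _+_ (δ-≢ (non-neighbour xy)) (δ-≢ (non-neighbour xz)))
      where
      non-neighbour : ∀ {w} → adj x w ≡ true → k ≢ w
      non-neighbour xw refl with () ← trans (sym xk) xw

  module Unrolled {n} {adj : Adjacency n} {p : ℕ → Fin n} (U : Unrolling adj p) where
    open Unrolling U

    walks-step : ∀ h a w → walks adj (suc h) (p (suc a)) w ≡ walks adj h (p (suc (suc a))) w + walks adj h (p a) w
    walks-step h a w = sum-two-neighbours adj (p (suc a)) (p (suc (suc a))) (p a)
      (forward (suc a)) (backward a) (no-backtrack a) (neighbours a) (λ k → walks adj h k w)

    walks-unrolled : ∀ h a w R → h ≤ a → a + h < R →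
      walks adj h (p a) w ≡ sumTo R (λ b → lineWalks h a b * δ (p b) w)
    walks-unrolled zero a w R _ a<R = sym (trans
      (sumTo-cong R λ b → trans (*-comm (δℕ a b) _) (cong (δ (p b) w *_) (δℕ-sym a b)))
      (sumTo-δ R a (λ b → δ (p b) w) (≤-<-trans (m≤m+n a 0) a<R)))
    walks-unrolled (suc h) (suc a) w R (s≤s h≤a) a+h<R = begin
      walks adj (suc h) (p (suc a)) w
        ≡⟨ walks-step h a w ⟩
      walks adj h (p (suc (suc a))) w + walks adj h (p a) w
        ≡⟨ cong₂ _+_ (walks-unrolled h (suc (suc a)) w R (m≤n⇒m≤1+n (m≤n⇒m≤1+n h≤a)) (subst (_< R) (+-suc (suc a) h) a+h<R))
                     (walks-unrolled h a w R h≤a (≤-<-trans (+-mono-≤ (n≤1+n a) (n≤1+n h)) a+h<R)) ⟩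
      sumTo R (λ b → lineWalks h (suc (suc a)) b * δ (p b) w) + sumTo R (λ b → lineWalks h a b * δ (p b) w)
        ≡⟨ sym (sumTo-+ R _ _) ⟩
      sumTo R (λ b → lineWalks h (suc (suc a)) b * δ (p b) w + lineWalks h a b * δ (p b) w)
        ≡⟨ sumTo-cong R (λ b → sym (*-distribʳ-+ (δ (p b) w) (lineWalks h (suc (suc a)) b) (lineWalks h a b))) ⟩
      sumTo R (λ b → lineWalks (suc h) (suc a) b * δ (p b) w) ∎
      where open ≡-Reasoning

    lineWalks-weighted≤walks : ∀ h a (χ : ℕ → ℕ) → h ≤ a → (∀ b → χ b ≤ δ (p b) (p a)) →
      sumTo (suc (a + h)) (λ b → lineWalks h a b * χ b) ≤ walks adj h (p a) (p a)
    lineWalks-weighted≤walks h a χ h≤a χ≤ = begin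
      sumTo R (λ b → lineWalks h a b * χ b)            ≤⟨ sumTo-mono R (λ b → *-monoʳ-≤ (lineWalks h a b) (χ≤ b)) ⟩
      sumTo R (λ b → lineWalks h a b * δ (p b) (p a))  ≡⟨ sym (walks-unrolled h a (p a) R h≤a ≤-refl) ⟩
      walks adj h (p a) (p a)                          ∎
      where
      open ≤-Reasoning
      R = suc (a + h)

    lineWalks≤walks : ∀ h a → h ≤ a → lineWalks h a a ≤ walks adj h (p a) (p a)
    lineWalks≤walks h a h≤a =
      subst (_≤ walks adj h (p a) (p a)) (sumTo-δ (suc (a + h)) a (lineWalks h a) (s≤s (m≤m+n a h)))
        (lineWalks-weighted≤walks h a (λ b → δℕ b a) h≤a at-a)
      where
      at-a : ∀ b → δℕ b a ≤ δ (p b) (p a)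
      at-a b with b ≟ a
      ... | yes refl = ≤-reflexive (sym (δ-refl (p b)))
      ... | no  _    = z≤n

    lineWalks+return≤walks : ∀ h a b′ → h ≤ a → b′ ≢ a → b′ ≤ a + h → p b′ ≡ p a →
      lineWalks h a a + lineWalks h a b′ ≤ walks adj h (p a) (p a)
    lineWalks+return≤walks h a b′ h≤a b′≢a b′≤ same =
      subst (_≤ walks adj h (p a) (p a)) picks (lineWalks-weighted≤walks h a (λ b → δℕ b a + δℕ b b′) h≤a at-a-or-b′)
      where
      R = suc (a + h)
      picks : sumTo R (λ b → lineWalks h a b * (δℕ b a + δℕ b b′)) ≡ lineWalks h a a + lineWalks h a b′
      picks = trans (sumTo-cong R (λ b → *-distribˡ-+ (lineWalks h a b) (δℕ b a) (δℕ b b′)))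
        (trans (sumTo-+ R _ _) (cong₂ _+_ (sumTo-δ R a (lineWalks h a) (s≤s (m≤m+n a h))) (sumTo-δ R b′ (lineWalks h a) (s≤s b′≤))))
      at-a-or-b′ : ∀ b → δℕ b a + δℕ b b′ ≤ δ (p b) (p a)
      at-a-or-b′ b with b ≟ a | b ≟ b′
      ... | yes refl | yes refl = ⊥-elim (b′≢a refl)
      ... | yes refl | no _     = ≤-reflexive (sym (δ-refl (p b)))
      ... | no _     | yes refl = ≤-reflexive (sym (trans (cong (λ x → δ x (p a)) same) (δ-refl (p a))))
      ... | no _     | no _     = z≤n

module CycleArithmetic (m : ℕ) where

  open import Data.Nat
  open import Data.Nat.Properties
  open import Data.Nat.DivMod
  open import Data.Fin as F using (Fin; toℕ; fromℕ<)
  import Data.Fin.Properties as FP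
  open import Data.Bool using (true)
  open import Data.Sum using (_⊎_; inj₁; inj₂)
  open import Relation.Nullary using (yes; no)
  open import Relation.Binary.PropositionalEquality
  open import Data.Empty using (⊥-elim)

  N : ℕ
  N = 3 + m

  cycleAdj-elim : ∀ (i j : Fin N) → cycleAdj N i j ≡ true → toℕ j ≡ suc (toℕ i) % N ⊎ toℕ i ≡ suc (toℕ j) % N
  cycleAdj-elim i j e with toℕ j ≟ suc (toℕ i) % N | toℕ i ≟ suc (toℕ j) % N
  ... | yes j-next | _        = inj₁ j-next
  ... | no _       | yes i-next = inj₂ i-next

  cycleAdj-next : ∀ (i j : Fin N) → toℕ j ≡ suc (toℕ i) % N → cycleAdj N i j ≡ true
  cycleAdj-next i j j-next with toℕ j ≟ suc (toℕ i) % N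
  ... | yes _ = refl
  ... | no ¬j-next = ⊥-elim (¬j-next j-next)

  cycleAdj-prev : ∀ (i j : Fin N) → toℕ i ≡ suc (toℕ j) % N → cycleAdj N i j ≡ true
  cycleAdj-prev i j i-next with toℕ j ≟ suc (toℕ i) % N | toℕ i ≟ suc (toℕ j) % N
  ... | yes _ | _ = refl
  ... | no _ | yes _ = refl
  ... | no _ | no ¬i-next = ⊥-elim (¬i-next i-next)

  %N-id : ∀ {x} → x < N → x % N ≡ x
  %N-id = m<n⇒m%n≡m

  suc-% : ∀ a → suc (a % N) % N ≡ suc a % N
  suc-% a = sym (trans (%-distribˡ-+ 1 a N) (cong (λ x → (x + a % N) % N) (%N-id {1} (s≤s (s≤s z≤n)))))

  %-shift-≢ : ∀ x d → 0 < d → d < N → (x + d) % N ≢ x % N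
  %-shift-≢ x d 0<d d<N e with r + d <? N
    where r = x % N
  ... | yes r+d<N = <⇒≢ (m<m+n (x % N) 0<d) (sym (trans (sym (%N-id r+d<N)) e′))
    where
    e′ : (x % N + d) % N ≡ x % N
    e′ = trans (trans (cong (λ y → (x % N + y) % N) (sym (%N-id d<N))) (sym (%-distribˡ-+ x d N))) e
  ... | no r+d≮N = <⇒≢ d<N (+-cancelˡ-≡ r d N (trans (sym (m∸n+n≡m N≤r+d)) (cong (_+ N) wrapped)))
    where
    r = x % N
    e′ : (r + d) % N ≡ r
    e′ = trans (trans (cong (λ y → (r + y) % N) (sym (%N-id d<N))) (sym (%-distribˡ-+ x d N))) e
    N≤r+d : N ≤ r + d
    N≤r+d = ≮⇒≥ r+d≮N
    wrapped : r + d ∸ N ≡ r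
    wrapped = trans (sym (%N-id (+-cancelʳ-< _ _ N (subst (_< N + N) (sym (m∸n+n≡m N≤r+d)) (+-mono-< (m%n<n x N) d<N)))))
                    (trans (m≤n⇒[n∸m]%m≡n%m N≤r+d) e′)

  pos : ℕ → Fin N
  pos a = fromℕ< (m%n<n a N)

  toℕ-pos : ∀ a → toℕ (pos a) ≡ a % N
  toℕ-pos a = FP.toℕ-fromℕ< (m%n<n a N)

  %-≡⇒pos-≡ : ∀ {a b} → a % N ≡ b % N → pos a ≡ pos b
  %-≡⇒pos-≡ {a} {b} e = FP.toℕ-injective (trans (toℕ-pos a) (trans e (sym (toℕ-pos b))))

  pos-≡⇒%-≡ : ∀ {a b} → pos a ≡ pos b → a % N ≡ b % N
  pos-≡⇒%-≡ {a} {b} e = trans (sym (toℕ-pos a)) (trans (cong toℕ e) (toℕ-pos b))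

  pos-+N : ∀ a → pos (a + N) ≡ pos a
  pos-+N a = %-≡⇒pos-≡ {a + N} {a} ([m+n]%n≡m%n a N)

  pos-toℕ : ∀ (i : Fin N) → pos (toℕ i) ≡ i
  pos-toℕ i = FP.toℕ-injective (trans (toℕ-pos (toℕ i)) (%N-id (FP.toℕ<n i)))

  suc-%-injective : ∀ x y → suc x % N ≡ suc y % N → x % N ≡ y % N
  suc-%-injective x y e = begin
    x % N                  ≡⟨ sym ([m+n]%n≡m%n x N) ⟩
    (x + N) % N            ≡⟨ cong (_% N) (+-suc x (2 + m)) ⟩
    (suc x + (2 + m)) % N  ≡⟨ %-distribˡ-+ (suc x) (2 + m) N ⟩
    (suc x % N + (2 + m) % N) % N ≡⟨ cong (λ z → (z + (2 + m) % N) % N) e ⟩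
    (suc y % N + (2 + m) % N) % N ≡⟨ sym (%-distribˡ-+ (suc y) (2 + m) N) ⟩
    (suc y + (2 + m)) % N  ≡⟨ cong (_% N) (sym (+-suc y (2 + m))) ⟩
    (y + N) % N            ≡⟨ [m+n]%n≡m%n y N ⟩
    y % N                  ∎
    where open ≡-Reasoning

  pos-next : ∀ a → toℕ (pos (suc a)) ≡ suc (toℕ (pos a)) % N
  pos-next a = trans (toℕ-pos (suc a)) (trans (sym (suc-% a)) (cong (λ x → suc x % N) (sym (toℕ-pos a))))

  cycleAdj-pos-forward : ∀ a → cycleAdj N (pos a) (pos (suc a)) ≡ true
  cycleAdj-pos-forward a = cycleAdj-next (pos a) (pos (suc a)) (pos-next a)

  cycleAdj-pos-backward : ∀ a → cycleAdj N (pos (suc a)) (pos a) ≡ true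
  cycleAdj-pos-backward a = cycleAdj-prev (pos (suc a)) (pos a) (pos-next a)

  cycleAdj-pos-neighbours : ∀ a j → cycleAdj N (pos (suc a)) j ≡ true → j ≡ pos (suc (suc a)) ⊎ j ≡ pos a
  cycleAdj-pos-neighbours a j e with cycleAdj-elim (pos (suc a)) j e
  ... | inj₁ j-next = inj₁ (FP.toℕ-injective (trans j-next (sym (pos-next (suc a)))))
  ... | inj₂ j-prev = inj₂ (FP.toℕ-injective (begin
    toℕ j      ≡⟨ sym (%N-id (FP.toℕ<n j)) ⟩
    toℕ j % N  ≡⟨ sym (suc-%-injective a (toℕ j) (trans (sym (toℕ-pos (suc a))) j-prev)) ⟩
    a % N      ≡⟨ sym (toℕ-pos a) ⟩
    toℕ (pos a) ∎))
    where open ≡-Reasoning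

  pos-no-backtrack : ∀ a → pos (suc (suc a)) ≢ pos a
  pos-no-backtrack a e = %-shift-≢ a 2 (s≤s z≤n) (s≤s (s≤s (s≤s z≤n))) (trans (cong (_% N) (+-comm a 2)) (pos-≡⇒%-≡ {suc (suc a)} {a} e))

  pos-injective-window : ∀ a b → a ≤ b → b < a + N → pos a ≡ pos b → a ≡ b
  pos-injective-window a b a≤b b<a+N e with m≤n⇒m<n∨m≡n a≤b
  ... | inj₂ a≡b = a≡b
  ... | inj₁ a<b = ⊥-elim (%-shift-≢ a (b ∸ a) (m<n⇒0<n∸m a<b)
          (subst (b ∸ a <_) (m+n∸m≡n a N) (∸-monoˡ-< b<a+N a≤b))
          (trans (cong (_% N) (m+[n∸m]≡n a≤b)) (sym (pos-≡⇒%-≡ {a} {b} e))))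

module CycleLabellings (m : ℕ) where

  open import Data.Nat
  open import Data.Nat.Properties
  open import Data.Fin using (Fin; toℕ)
  open import Data.Bool using (true)
  open import Data.Sum using (_⊎_; inj₁; inj₂)
  open import Data.Product using (_,_; ∃; proj₁; proj₂)
  open import Relation.Nullary using (yes; no)
  open import Relation.Binary.PropositionalEquality
  open import Function.Bundles using (Bijection; mk⤖)
  open KroneckerSums
  open WalkCounts using (walks; closedWalks)
  open LineWalks
  open Unrollings
  open CycleArithmetic m

  record CycleLabelling (adj : Adjacency N) : Set where
    field
      vertex          : Fin N → Fin N
      position        : Fin N → Fin N
      vertex-position : ∀ v → vertex (position v) ≡ v
      position-vertex : ∀ i → position (vertex i) ≡ i
      adj-vertex      : ∀ i j → adj (vertex i) (vertex j) ≡ cycleAdj N i j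

  labelling-from-iso : ∀ {adj : Adjacency N} → GraphIso adj (cycleAdj N) → CycleLabelling adj
  labelling-from-iso {adj} iso = record
    { vertex          = vertex
    ; position        = φ
    ; vertex-position = λ v → Bijection.injective (GraphIso.φ iso) (φ-vertex (φ v))
    ; position-vertex = φ-vertex
    ; adj-vertex      = λ i j → trans (GraphIso.preserves iso (vertex i) (vertex j)) (cong₂ (cycleAdj N) (φ-vertex i) (φ-vertex j))
    }
    where
    φ = Bijection.to (GraphIso.φ iso)
    vertex : Fin N → Fin N
    vertex i = proj₁ (Bijection.surjective (GraphIso.φ iso) i)
    φ-vertex : ∀ i → φ (vertex i) ≡ i
    φ-vertex i = proj₂ (Bijection.surjective (GraphIso.φ iso) i) refl

  module Labelled {adj : Adjacency N} (L : CycleLabelling adj) where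
    open CycleLabelling L

    vertex-injective : ∀ {i j} → vertex i ≡ vertex j → i ≡ j
    vertex-injective {i} {j} e = trans (sym (position-vertex i)) (trans (cong position e) (position-vertex j))

    at : ℕ → Fin N
    at a = vertex (pos a)

    unrolling : Unrolling adj at
    unrolling = record
      { forward      = λ a → trans (adj-vertex (pos a) (pos (suc a))) (cycleAdj-pos-forward a)
      ; backward     = λ a → trans (adj-vertex (pos (suc a)) (pos a)) (cycleAdj-pos-backward a)
      ; neighbours   = neighbours
      ; no-backtrack = λ a e → pos-no-backtrack a (vertex-injective e)
      }
      where
      neighbours : ∀ a k → adj (at (suc a)) k ≡ true → k ≡ at (suc (suc a)) ⊎ k ≡ at a
      neighbours a k e with cycleAdj-pos-neighbours a (position k)
                              (trans (sym (adj-vertex (pos (suc a)) (position k))) (trans (cong (adj (at (suc a))) (vertex-position k)) e))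
      ... | inj₁ k-next = inj₁ (trans (sym (vertex-position k)) (cong vertex k-next))
      ... | inj₂ k-prev = inj₂ (trans (sym (vertex-position k)) (cong vertex k-prev))

    open Unrolled unrolling

    -- a preimage of v under at, far enough from 0 for lineWalks to be honest
    anchor : Fin N → ℕ
    anchor v = toℕ (position v) + N

    at-anchor : ∀ v → at (anchor v) ≡ v
    at-anchor v = trans (cong vertex (trans (pos-+N (toℕ (position v))) (pos-toℕ (position v)))) (vertex-position v)

    -- Below length N a closed walk cannot wind around the cycle, so it is a closed line walk.
    walks-cycle : ∀ h v → h < N → walks adj h v v ≡ lineWalks h h h
    walks-cycle h v h<N = begin
      walks adj h v v                                     ≡⟨ cong (λ x → walks adj h x x) (sym (at-anchor v)) ⟩
      walks adj h (at a) (at a)                           ≡⟨ walks-unrolled h a (at a) R h≤a ≤-refl ⟩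
      sumTo R (λ b → lineWalks h a b * δ (at b) (at a))   ≡⟨ sumTo-cong R unwound ⟩
      sumTo R (λ b → lineWalks h a b * δℕ b a)            ≡⟨ sumTo-δ R a (lineWalks h a) (s≤s (m≤m+n a h)) ⟩
      lineWalks h a a                                     ≡⟨ lineWalks-diag h a h≤a ⟩
      lineWalks h h h                                     ∎
      where
      open ≡-Reasoning
      a = anchor v
      R = suc (a + h)
      h≤a : h ≤ a
      h≤a = ≤-trans (<⇒≤ h<N) (m≤n+m N (toℕ (position v)))
      unwound : ∀ b → lineWalks h a b * δ (at b) (at a) ≡ lineWalks h a b * δℕ b a
      unwound b with b ≟ a | a + h <? b | b + h <? a
      ... | yes refl | _ | _ = cong (lineWalks h a b *_) (δ-refl (at b))
      ... | no _ | yes far | _ = trans (cong (_* δ (at b) (at a)) (lineWalks-out-of-reachʳ h a b far)) (sym (*-zeroʳ (lineWalks h a b)))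
      ... | no _ | no _ | yes far = trans (cong (_* δ (at b) (at a)) (lineWalks-out-of-reachˡ h a b far)) (sym (*-zeroʳ (lineWalks h a b)))
      ... | no b≢a | no near₁ | no near₂ = cong (lineWalks h a b *_) (δ-≢ at-b≢at-a)
        where
        at-b≢at-a : at b ≢ at a
        at-b≢at-a e with ≤-total a b
        ... | inj₁ a≤b = b≢a (sym (pos-injective-window a b a≤b (≤-<-trans (≮⇒≥ near₁) (+-monoʳ-< a h<N)) (sym (vertex-injective e))))
        ... | inj₂ b≤a = b≢a (pos-injective-window b a b≤a (≤-<-trans (≮⇒≥ near₂) (+-monoʳ-< b h<N)) (vertex-injective e))

    closedWalks-cycle : ∀ h → h < N → closedWalks adj h ≡ N * lineWalks h h h
    closedWalks-cycle h h<N = trans (sum-cong-≗ λ v → walks-cycle h v h<N) (sum-const N (lineWalks h h h))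

  labellings⇒GraphIso : ∀ {adj adj′ : Adjacency N} → CycleLabelling adj → CycleLabelling adj′ → GraphIso adj adj′
  labellings⇒GraphIso {adj} {adj′} L L′ = record
    { φ         = mk⤖ {to = φ} (φ-injective , φ-surjective)
    ; preserves = λ u v → trans (cong₂ adj (sym (L.vertex-position u)) (sym (L.vertex-position v)))
                            (trans (L.adj-vertex (L.position u) (L.position v)) (sym (L′.adj-vertex (L.position u) (L.position v))))
    }
    where
    module L = CycleLabelling L
    module L′ = CycleLabelling L′
    φ : Fin N → Fin N
    φ u = L′.vertex (L.position u)
    φ-injective : ∀ {x y} → φ x ≡ φ y → x ≡ y
    φ-injective {x} {y} e = trans (sym (L.vertex-position x)) (trans (cong L.vertex (Labelled.vertex-injective L′ e)) (L.vertex-position y))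
    φ-surjective : ∀ y → ∃ λ x → ∀ {z} → z ≡ x → φ z ≡ y
    φ-surjective y = L.vertex (L′.position y) , λ { refl → trans (cong L′.vertex (L.position-vertex (L′.position y))) (L′.vertex-position y) }

module Counting where

  open import Data.Nat
  open import Data.Nat.Properties
  open import Data.Fin as F using (Fin; zero; suc)
  import Data.Fin.Properties as FP
  open import Data.Bool using (Bool; true; false)
  open import Data.Sum using (_⊎_; inj₁; inj₂)
  open import Data.Product using (_×_; _,_; ∃)
  open import Relation.Binary.PropositionalEquality
  open import Function using (_∘_)
  open KroneckerSums

  sum≡0 : ∀ {n} (f : Fin n → ℕ) → sum f ≡ 0 → ∀ i → f i ≡ 0
  sum≡0 {suc n} f e zero    = m+n≡0⇒m≡0 (f zero) e
  sum≡0 {suc n} f e (suc i) = sum≡0 (f ∘ suc) (m+n≡0⇒n≡0 (f zero) e) i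

  sum-mono-tight : ∀ {n} (f g : Fin n → ℕ) → (∀ i → f i ≤ g i) → sum g ≤ sum f → ∀ i → f i ≡ g i
  sum-mono-tight {suc n} f g f≤g Σg≤Σf zero = ≤-antisym (f≤g zero)
    (+-cancelʳ-≤ (sum (g ∘ suc)) (g zero) (f zero) (≤-trans Σg≤Σf (+-monoʳ-≤ (f zero) (sum-mono (f≤g ∘ suc)))))
  sum-mono-tight {suc n} f g f≤g Σg≤Σf (suc i) = sum-mono-tight (f ∘ suc) (g ∘ suc) (f≤g ∘ suc)
    (+-cancelˡ-≤ (f zero) _ _ (≤-trans (+-monoˡ-≤ _ (f≤g zero)) Σg≤Σf)) i

  count : ∀ {n} → (Fin n → Bool) → ℕ
  count {n} P = ∑[ k < n ] 𝟙 (P k)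

  count≡0 : ∀ {n} (P : Fin n → Bool) → count P ≡ 0 → ∀ k → P k ≡ false
  count≡0 P e k with P k | sum≡0 (𝟙 ∘ P) e k
  ... | false | _ = refl

  count≡1 : ∀ {n} (P : Fin n → Bool) → count P ≡ 1 → ∃ λ y → P y ≡ true × (∀ k → P k ≡ true → k ≡ y)
  count≡1 {suc n} P e with P zero in P0
  ... | true = zero , P0 , only-zero
    where
    only-zero : ∀ k → P k ≡ true → k ≡ zero
    only-zero zero    _  = refl
    only-zero (suc k) Pk with () ← trans (sym Pk) (count≡0 (P ∘ suc) (suc-injective e) k)
  ... | false with count≡1 (P ∘ suc) e
  ...   | y , Py , only-y = suc y , Py , only-suc-y
    where
    only-suc-y : ∀ k → P k ≡ true → k ≡ suc y
    only-suc-y zero    Pk with () ← trans (sym Pk) P0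
    only-suc-y (suc k) Pk = cong suc (only-y k Pk)

  record ExactlyTwo {n} (P : Fin n → Bool) : Set where
    constructor exactlyTwo
    field
      first second   : Fin n
      P-first        : P first ≡ true
      P-second       : P second ≡ true
      first≢second   : first ≢ second
      first-or-second : ∀ k → P k ≡ true → k ≡ first ⊎ k ≡ second

  count≡2 : ∀ {n} (P : Fin n → Bool) → count P ≡ 2 → ExactlyTwo P
  count≡2 {suc n} P e with P zero in P0
  ... | true with count≡1 (P ∘ suc) (suc-injective e)
  ...   | y , Py , only-y = exactlyTwo zero (suc y) P0 Py (λ ()) only
    where
    only : ∀ k → P k ≡ true → k ≡ zero ⊎ k ≡ suc y
    only zero    _  = inj₁ refl
    only (suc k) Pk = inj₂ (cong suc (only-y k Pk))
  count≡2 {suc n} P e | false with count≡2 (P ∘ suc) e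
  ...   | exactlyTwo y z Py Pz y≢z only-yz = exactlyTwo (suc y) (suc z) Py Pz (y≢z ∘ FP.suc-injective) only
    where
    only : ∀ k → P k ≡ true → k ≡ suc y ⊎ k ≡ suc z
    only zero    Pk with () ← trans (sym Pk) P0
    only (suc k) Pk with only-yz k Pk
    ... | inj₁ k≡y = inj₁ (cong suc k≡y)
    ... | inj₂ k≡z = inj₂ (cong suc k≡z)

module DegreeMoments {n} (adj : Adjacency n) (adj-sym : ∀ i j → adj i j ≡ adj j i) where

  open import Data.Nat
  open import Data.Nat.Properties
  open import Data.Fin as F using (Fin)
  open import Data.Bool using (true; false)
  open import Relation.Nullary using (yes; no)
  open import Relation.Binary.PropositionalEquality
  open KroneckerSums
  open WalkCounts using (walks; closedWalks)

  A : Fin n → Fin n → ℕ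
  A i j = 𝟙 (adj i j)

  A-sym : ∀ i j → A i j ≡ A j i
  A-sym i j = cong 𝟙 (adj-sym i j)

  deg : Fin n → ℕ
  deg v = ∑[ k < n ] A v k

  walks-1 : ∀ i j → walks adj 1 i j ≡ A i j
  walks-1 i j = trans (sum-cong-≗ λ k → *-comm (A i k) (δ k j)) (sum-δ j (A i))

  walks-2 : ∀ i j → walks adj 2 i j ≡ ∑[ k < n ] (A i k * A k j)
  walks-2 i j = sum-cong-≗ λ k → cong (A i k *_) (walks-1 k j)

  walks-+ : ∀ a b i j → walks adj (a + b) i j ≡ ∑[ k < n ] (walks adj a i k * walks adj b k j)
  walks-+ zero b i j = sym (trans (sum-cong-≗ λ k → cong (_* walks adj b k j) (δ-sym i k)) (sum-δ i (λ k → walks adj b k j)))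
  walks-+ (suc a) b i j = begin
    ∑[ l < n ] (A i l * walks adj (a + b) l j)
      ≡⟨ sum-cong-≗ (λ l → cong (A i l *_) (walks-+ a b l j)) ⟩
    ∑[ l < n ] (A i l * ∑[ k < n ] (walks adj a l k * walks adj b k j))
      ≡⟨ sum-cong-≗ (λ l → *-distribˡ-sum (A i l) (λ k → walks adj a l k * walks adj b k j)) ⟩
    ∑[ l < n ] ∑[ k < n ] (A i l * (walks adj a l k * walks adj b k j))
      ≡⟨ ∑-comm (λ l k → A i l * (walks adj a l k * walks adj b k j)) ⟩
    ∑[ k < n ] ∑[ l < n ] (A i l * (walks adj a l k * walks adj b k j))
      ≡⟨ sum-cong-≗ (λ k → trans (sum-cong-≗ λ l → sym (*-assoc (A i l) _ _)) (sym (*-distribʳ-sum (walks adj b k j) (λ l → A i l * walks adj a l k)))) ⟩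
    ∑[ k < n ] (walks adj (suc a) i k * walks adj b k j) ∎
    where open ≡-Reasoning

  walks-2-sym : ∀ i j → walks adj 2 i j ≡ walks adj 2 j i
  walks-2-sym i j = trans (walks-2 i j)
    (trans (sum-cong-≗ λ k → trans (*-comm (A i k) (A k j)) (cong₂ _*_ (A-sym k j) (A-sym i k))) (sym (walks-2 j i)))

  walks-2-diag : ∀ v → walks adj 2 v v ≡ deg v
  walks-2-diag v = trans (walks-2 v v) (sum-cong-≗ λ k → trans (cong (A v k *_) (A-sym k v)) (𝟙-idem (adj v k)))
    where
    𝟙-idem : ∀ b → 𝟙 b * 𝟙 b ≡ 𝟙 b
    𝟙-idem true  = refl
    𝟙-idem false = refl

  closedWalks-2 : closedWalks adj 2 ≡ sum deg
  closedWalks-2 = sum-cong-≗ walks-2-diag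

  sum-walks-2 : ∀ v → ∑[ u < n ] walks adj 2 v u ≡ ∑[ k < n ] (A v k * deg k)
  sum-walks-2 v = trans (sum-cong-≗ (walks-2 v))
    (trans (∑-comm (λ u k → A v k * A k u)) (sum-cong-≗ λ k → sym (*-distribˡ-sum (A v k) (A k))))

  -- x ≤ x² applied to the row of A² through v, with the diagonal entry kept exact.
  walks-4-bound : ∀ v → ∑[ k < n ] (A v k * deg k) + deg v * deg v ≤ walks adj 4 v v + deg v
  walks-4-bound v = begin
    ∑[ k < n ] (A v k * deg k) + deg v * deg v
      ≡⟨ cong₂ _+_ (sym (sum-walks-2 v)) (cong₂ _*_ (sym (walks-2-diag v)) (sym (walks-2-diag v))) ⟩
    sum x + x v * x v
      ≡⟨ cong (sum x +_) (sym (sum-δ v (λ u → x u * x u))) ⟩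
    sum x + ∑[ u < n ] (δ u v * (x u * x u))
      ≡⟨ sym (∑-distrib-+ x (λ u → δ u v * (x u * x u))) ⟩
    ∑[ u < n ] (x u + δ u v * (x u * x u))
      ≤⟨ sum-mono termwise ⟩
    ∑[ u < n ] (x u * x u + δ u v * x u)
      ≡⟨ ∑-distrib-+ (λ u → x u * x u) (λ u → δ u v * x u) ⟩
    ∑[ u < n ] (x u * x u) + ∑[ u < n ] (δ u v * x u)
      ≡⟨ cong₂ _+_ (sym (trans (walks-+ 2 2 v v) (sum-cong-≗ λ u → cong (x u *_) (walks-2-sym u v)))) (sum-δ v x) ⟩
    walks adj 4 v v + x v
      ≡⟨ cong (walks adj 4 v v +_) (walks-2-diag v) ⟩
    walks adj 4 v v + deg v ∎
    where
    open ≤-Reasoning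
    x : Fin n → ℕ
    x u = walks adj 2 v u
    termwise : ∀ u → x u + δ u v * (x u * x u) ≤ x u * x u + δ u v * x u
    termwise u with u F.≟ v
    ... | yes refl = ≤-reflexive (trans (cong (x u +_) (+-identityʳ _)) (trans (+-comm (x u) _) (cong (x u * x u +_) (sym (+-identityʳ _)))))
    ... | no _ = +-mono-≤ (x≤x*x (x u)) z≤n
      where
      x≤x*x : ∀ y → y ≤ y * y
      x≤x*x zero    = z≤n
      x≤x*x (suc y) = m≤m*n (suc y) (suc y)

  closedWalks-4-bound : sum (λ v → deg v * deg v) + sum (λ v → deg v * deg v) ≤ closedWalks adj 4 + sum deg
  closedWalks-4-bound = begin
    sum (λ v → deg v * deg v) + sum (λ v → deg v * deg v)
      ≡⟨ cong (_+ sum (λ v → deg v * deg v)) (sym degree-weighted) ⟩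
    ∑[ v < n ] ∑[ k < n ] (A v k * deg k) + sum (λ v → deg v * deg v)
      ≡⟨ sym (∑-distrib-+ (λ v → ∑[ k < n ] (A v k * deg k)) (λ v → deg v * deg v)) ⟩
    ∑[ v < n ] (∑[ k < n ] (A v k * deg k) + deg v * deg v)
      ≤⟨ sum-mono walks-4-bound ⟩
    ∑[ v < n ] (walks adj 4 v v + deg v)
      ≡⟨ ∑-distrib-+ (λ v → walks adj 4 v v) deg ⟩
    closedWalks adj 4 + sum deg ∎
    where
    open ≤-Reasoning
    degree-weighted : ∑[ v < n ] ∑[ k < n ] (A v k * deg k) ≡ sum (λ v → deg v * deg v)
    degree-weighted = trans (∑-comm (λ v k → A v k * deg k))
      (sum-cong-≗ λ k → trans (sym (*-distribʳ-sum (deg k) (λ v → A v k))) (cong (_* deg k) (sum-cong-≗ λ v → A-sym v k)))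

module DegreeTwo where

  open import Data.Nat hiding (_+_)
  open import Data.Nat.Properties
  open import Data.Fin as F using (Fin)
  open import Data.Bool using (true; false)
  open import Relation.Nullary using (yes; no)
  open import Relation.Binary.PropositionalEquality
  open import Data.Empty using (⊥-elim)
  open import Data.Sum using (inj₁; inj₂)
  open KroneckerSums
  open WalkCounts using (walks; closedWalks)
  open LineWalks using (lineWalks)
  open Counting
  open import Data.Nat.Solver using (module +-*-Solver)

  HasCycleWalkCounts : (N : ℕ) → Adjacency N → Set
  HasCycleWalkCounts N adj = ∀ h → h < N → closedWalks adj h ≡ N * lineWalks h h h

  module SimpleDegrees {n} {adj : Adjacency n} (simple : IsSimpleGraph adj) where
    open IsSimpleGraph simple
    open DegreeMoments adj adj-sym public

    private
      𝟙≤1 : ∀ b → 𝟙 b ≤ 1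
      𝟙≤1 true  = ≤-refl
      𝟙≤1 false = z≤n

      row-with-diagonal : ∀ v → ∑[ k < n ] (A v k + δ k v) ≡ suc (deg v)
      row-with-diagonal v = trans (∑-distrib-+ (A v) (λ k → δ k v)) (trans (cong (deg v +_) (sum-δ≡1 v)) (+-comm (deg v) 1))

      row-entry≤1 : ∀ v k → A v k + δ k v ≤ 1
      row-entry≤1 v k with k F.≟ v
      ... | yes refl = ≤-reflexive (cong (_+ 1) (cong 𝟙 (irrefl k)))
      ... | no _     = ≤-trans (≤-reflexive (+-identityʳ (A v k))) (𝟙≤1 (adj v k))

      row-tight : ∀ v → n ≤ suc (deg v) → ∀ k → A v k + δ k v ≡ 1
      row-tight v full = sum-mono-tight (λ k → A v k + δ k v) (λ _ → 1) (row-entry≤1 v)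
        (subst₂ _≤_ (sym (trans (sum-const n 1) (*-identityʳ n))) (sym (row-with-diagonal v)) full)

    deg<n : ∀ v → deg v < n
    deg<n v = subst₂ _≤_ (row-with-diagonal v) (trans (sum-const n 1) (*-identityʳ n)) (sum-mono (row-entry≤1 v))

    full-degree⇒adjacent : ∀ v → n ≤ suc (deg v) → ∀ k → k ≢ v → adj v k ≡ true
    full-degree⇒adjacent v full k k≢v with adj v k in vk
    ... | true  = refl
    ... | false with () ← trans (sym (row-tight v full k)) (cong₂ _+_ (cong 𝟙 vk) (δ-≢ k≢v))

    degrees≤2⇒degrees≡2 : (∀ v → deg v ≤ 2) → n * 2 ≤ sum deg → ∀ v → deg v ≡ 2
    degrees≤2⇒degrees≡2 deg≤2 Σdeg≥ = sum-mono-tight deg (λ _ → 2) deg≤2 (≤-trans (≤-reflexive (sum-const n 2)) Σdeg≥)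

    triangle-free : closedWalks adj 3 ≡ 0 → ∀ v k l → A v k * (A k l * A l v) ≡ 0
    triangle-free none v k l = sum≡0 (λ l → A v k * (A k l * A l v)) through-k l
      where
      through-k : ∑[ l < n ] (A v k * (A k l * A l v)) ≡ 0
      through-k = begin
        ∑[ l < n ] (A v k * (A k l * A l v))  ≡⟨ sym (*-distribˡ-sum (A v k) (λ l → A k l * A l v)) ⟩
        A v k * ∑[ l < n ] (A k l * A l v)    ≡⟨ cong (A v k *_) (sym (walks-2 k v)) ⟩
        A v k * walks adj 2 k v               ≡⟨ sum≡0 (λ k → A v k * walks adj 2 k v) (sum≡0 (λ v → walks adj 3 v v) none v) k ⟩
        0                                     ∎
        where open ≡-Reasoning

    full-vertex⇒few-edges : closedWalks adj 3 ≡ 0 → ∀ v → n ≤ suc (deg v) → sum deg < n * 2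
    full-vertex⇒few-edges none v full = begin-strict
      sum deg                                   <⟨ m<m+n (sum deg) (s≤s z≤n) ⟩
      sum deg + 1                               ≡⟨ cong (sum deg +_) (sym (sum-δ≡1 v)) ⟩
      sum deg + ∑[ k < n ] δ k v                ≡⟨ sym (∑-distrib-+ deg (λ k → δ k v)) ⟩
      ∑[ k < n ] (deg k + δ k v)                ≤⟨ sum-mono bound ⟩
      ∑[ k < n ] (δ k v * n + 1)                ≡⟨ ∑-distrib-+ (λ k → δ k v * n) (λ _ → 1) ⟩
      ∑[ k < n ] (δ k v * n) + ∑[ k < n ] 1     ≡⟨ cong₂ _+_ (sum-δ v (λ _ → n)) (trans (sum-const n 1) (*-identityʳ n)) ⟩
      n + n                                     ≡⟨ +-*-double n ⟩
      n * 2                                     ∎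
      where
      open ≤-Reasoning
      +-*-double : ∀ n → n + n ≡ n * 2
      +-*-double n = trans (cong (n +_) (sym (+-identityʳ n))) (*-comm 2 n)
      leaf : ∀ k → k ≢ v → deg k ≤ 1
      leaf k k≢v = ≤-trans (sum-mono only-v) (≤-reflexive (sum-δ≡1 v))
        where
        only-v : ∀ l → A k l ≤ δ l v
        only-v l with l F.≟ v
        ... | yes refl = 𝟙≤1 (adj k l)
        ... | no l≢v = ≤-reflexive (begin-equality
          A k l                          ≡⟨ sym (*-identityʳ (A k l)) ⟩
          A k l * 1                      ≡⟨ cong (A k l *_) (cong 𝟙 (sym lv)) ⟩
          A k l * A l v                  ≡⟨ sym (*-identityˡ (A k l * A l v)) ⟩
          1 * (A k l * A l v)            ≡⟨ cong (_* (A k l * A l v)) (cong 𝟙 (sym vk)) ⟩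
          A v k * (A k l * A l v)        ≡⟨ triangle-free none v k l ⟩
          0                              ∎)
          where
          vk : adj v k ≡ true
          vk = full-degree⇒adjacent v full k k≢v
          lv : adj l v ≡ true
          lv = trans (adj-sym l v) (full-degree⇒adjacent v full l l≢v)
      bound : ∀ k → deg k + δ k v ≤ δ k v * n + 1
      bound k with k F.≟ v
      ... | yes refl = +-monoˡ-≤ 1 (≤-trans (<⇒≤ (deg<n k)) (m≤m+n n 0))
      ... | no k≢v = ≤-trans (≤-reflexive (+-identityʳ (deg k))) (leaf k k≢v)

    deviation² : Fin n → ℕ
    deviation² u = ∣ deg u - 2 ∣ * ∣ deg u - 2 ∣

    sum-deviation² : sum deviation² + 4 * sum deg ≡ sum (λ u → deg u * deg u) + n * 4
    sum-deviation² = begin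
      sum deviation² + 4 * sum deg                   ≡⟨ cong (sum deviation² +_) (*-distribˡ-sum 4 deg) ⟩
      sum deviation² + ∑[ u < n ] (4 * deg u)        ≡⟨ sym (∑-distrib-+ deviation² (λ u → 4 * deg u)) ⟩
      ∑[ u < n ] (deviation² u + 4 * deg u)          ≡⟨ sum-cong-≗ (λ u → expand (deg u)) ⟩
      ∑[ u < n ] (deg u * deg u + 4)           ≡⟨ ∑-distrib-+ (λ u → deg u * deg u) (λ _ → 4) ⟩
      sum (λ u → deg u * deg u) + ∑[ u < n ] 4 ≡⟨ cong (sum (λ u → deg u * deg u) +_) (sum-const n 4) ⟩
      sum (λ u → deg u * deg u) + n * 4        ∎
      where
      open ≡-Reasoning
      open +-*-Solver
      expand : ∀ d → ∣ d - 2 ∣ * ∣ d - 2 ∣ + 4 * d ≡ d * d + 4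
      expand zero          = refl
      expand (suc zero)    = refl
      expand (suc (suc d)) rewrite ∣-∣-identityʳ d =
        solve 1 (λ x → x :* x :+ con 4 :* (con 2 :+ x) := (con 2 :+ x) :* (con 2 :+ x) :+ con 4) refl d

    -- Σ (deg − 2)² = Σ deg² − 4 Σ deg + 4n, and the fourth closed-walk count bounds
    -- Σ deg² by 4n.
    moments⇒degrees≡2 : closedWalks adj 2 ≡ n * 2 → closedWalks adj 4 ≡ n * 6 → ∀ v → deg v ≡ 2
    moments⇒degrees≡2 T2 T4 v = ∣m-n∣≡0⇒m≡n (square≡0 _ (sum≡0 deviation² Σdeviation²≡0 v))
      where
      open +-*-Solver
      S = sum (λ u → deg u * deg u)
      Σdeg : sum deg ≡ n * 2
      Σdeg = trans (sym closedWalks-2) T2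
      square≡0 : ∀ x → x * x ≡ 0 → x ≡ 0
      square≡0 zero _ = refl
      S≤ : S ≤ n * 4
      S≤ = *-cancelˡ-≤ 2 (begin
        2 * S                        ≡⟨ solve 1 (λ x → con 2 :* x := x :+ x) refl S ⟩
        S + S                        ≤⟨ closedWalks-4-bound ⟩
        closedWalks adj 4 + sum deg  ≡⟨ cong₂ _+_ T4 Σdeg ⟩
        n * 6 + n * 2                ≡⟨ solve 1 (λ x → x :* con 6 :+ x :* con 2 := con 2 :* (x :* con 4)) refl n ⟩
        2 * (n * 4)                  ∎)
        where open ≤-Reasoning
      Σdeviation²≡0 : sum deviation² ≡ 0
      Σdeviation²≡0 = n≤0⇒n≡0 (+-cancelʳ-≤ (4 * (n * 2)) _ 0 (begin
        sum deviation² + 4 * (n * 2)  ≡⟨ cong (λ t → sum deviation² + 4 * t) (sym Σdeg) ⟩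
        sum deviation² + 4 * sum deg  ≡⟨ sum-deviation² ⟩
        S + n * 4                    ≤⟨ +-monoˡ-≤ (n * 4) S≤ ⟩
        n * 4 + n * 4                ≡⟨ solve 1 (λ x → x :* con 4 :+ x :* con 4 := con 4 :* (x :* con 2)) refl n ⟩
        4 * (n * 2)                  ∎))
        where open ≤-Reasoning

  degrees≡2 : ∀ m {adj : Adjacency (3 + m)} (simple : IsSimpleGraph adj) → HasCycleWalkCounts (3 + m) adj →
    ∀ v → SimpleDegrees.deg simple v ≡ 2
  degrees≡2 zero simple counts =
    degrees≤2⇒degrees≡2 (λ v → ≤-pred (deg<n v)) (≤-reflexive (sym (trans (sym closedWalks-2) (counts 2 (s≤s (s≤s (s≤s z≤n)))))))
    where open SimpleDegrees simple
  degrees≡2 (suc zero) simple counts = degrees≤2⇒degrees≡2 deg≤2 (≤-reflexive (sym Σdeg))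
    where
    open SimpleDegrees simple
    Σdeg : sum deg ≡ 8
    Σdeg = trans (sym closedWalks-2) (counts 2 (s≤s (s≤s (s≤s z≤n))))
    deg≤2 : ∀ v → deg v ≤ 2
    deg≤2 v with m≤n⇒m<n∨m≡n (≤-pred (deg<n v))
    ... | inj₁ deg<3  = ≤-pred deg<3
    ... | inj₂ deg≡3 = ⊥-elim (<-irrefl Σdeg
          (full-vertex⇒few-edges (counts 3 (s≤s (s≤s (s≤s (s≤s z≤n))))) v (≤-reflexive (sym (cong suc deg≡3)))))
  degrees≡2 (suc (suc m)) simple counts = moments⇒degrees≡2
    (counts 2 (s≤s (s≤s (s≤s z≤n)))) (counts 4 (s≤s (s≤s (s≤s (s≤s (s≤s z≤n))))))
    where open SimpleDegrees simple

  TwoRegular : ∀ {n} → Adjacency n → Set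
  TwoRegular adj = ∀ x → ExactlyTwo (adj x)

  twoRegular : ∀ m {adj : Adjacency (3 + m)} → IsSimpleGraph adj → HasCycleWalkCounts (3 + m) adj → TwoRegular adj
  twoRegular m {adj} simple counts x = count≡2 (adj x) (degrees≡2 m simple counts x)

module FinFacts where

  open import Data.Nat hiding (_+_)
  open import Data.Nat.Properties using (<-irrefl; ≤-refl)
  open import Data.Fin as F using (Fin; toℕ)
  import Data.Fin.Properties as FP
  open import Data.Product using (_×_; _,_; ∃)
  open import Relation.Nullary using (yes; no)
  open import Relation.Binary.PropositionalEquality
  open import Data.Empty using (⊥-elim)

  injective⇒surjective : ∀ {n} (f : Fin n → Fin n) → (∀ {x y} → f x ≡ f y → x ≡ y) → ∀ y → ∃ λ x → f x ≡ y
  injective⇒surjective {suc n} f f-inj y with FP.any? (λ x → f x F.≟ y)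
  ... | yes hit = hit
  ... | no miss = ⊥-elim (<-irrefl refl (FP.injective⇒≤ {f = g} g-inj))
    where
    f≢y : ∀ x → y ≢ f x
    f≢y x e = miss (x , sym e)
    g : Fin (suc n) → Fin n
    g x = F.punchOut (f≢y x)
    g-inj : ∀ {x z} → g x ≡ g z → x ≡ z
    g-inj {x} {z} e = f-inj (FP.punchOut-injective (f≢y x) (f≢y z) e)

  pigeonhole-pair : ∀ {n} (f g : ℕ → Fin n) → ∃ λ i → ∃ λ j → i < j × f i ≡ f j × g i ≡ g j
  pigeonhole-pair {n} f g with FP.pigeonhole ≤-refl code
    where
    code : Fin (suc (n * n)) → Fin (n * n)
    code k = F.combine (f (toℕ k)) (g (toℕ k))
  ... | i , j , i<j , e = toℕ i , toℕ j , i<j , FP.combine-injective (f (toℕ i)) (g (toℕ i)) (f (toℕ j)) (g (toℕ j)) e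

module NonBacktrackingWalks {n} {adj : Adjacency n} (simple : IsSimpleGraph adj) (R : DegreeTwo.TwoRegular adj) where

  open import Data.Nat hiding (_+_)
  open import Data.Nat.Properties
  open import Data.Fin as F using (Fin)
  open import Data.Bool using (true)
  open import Data.Sum using (_⊎_; inj₁; inj₂)
  open import Data.Product using (_×_; _,_; ∃; proj₁)
  open import Relation.Nullary using (yes; no)
  open import Relation.Binary.PropositionalEquality
  open import Data.Empty using (⊥-elim)
  open import Function using (_∘_)
  open IsSimpleGraph simple
  open module Neighbours (x : Fin n) = Counting.ExactlyTwo (R x) public
    renaming (first to nbr₁; second to nbr₂; P-first to adj-nbr₁; P-second to adj-nbr₂;
              first≢second to nbr₁≢nbr₂; first-or-second to only-nbrs)
  open WalkCounts using (walks)
  open LineWalks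
  open Unrollings
  open FinFacts

  other : Fin n → Fin n → Fin n
  other x z with z F.≟ nbr₁ x
  ... | yes _ = nbr₂ x
  ... | no  _ = nbr₁ x

  adj-other : ∀ x z → adj x (other x z) ≡ true
  adj-other x z with z F.≟ nbr₁ x
  ... | yes _ = adj-nbr₂ x
  ... | no  _ = adj-nbr₁ x

  other-nbr₁ : ∀ x → other x (nbr₁ x) ≡ nbr₂ x
  other-nbr₁ x with nbr₁ x F.≟ nbr₁ x
  ... | yes _ = refl
  ... | no ≢ = ⊥-elim (≢ refl)

  other-nbr₂ : ∀ x → other x (nbr₂ x) ≡ nbr₁ x
  other-nbr₂ x with nbr₂ x F.≟ nbr₁ x
  ... | yes e = ⊥-elim (nbr₁≢nbr₂ x (sym e))
  ... | no  _ = refl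

  module _ (x z : Fin n) (xz : adj x z ≡ true) where

    other-only : ∀ k → adj x k ≡ true → k ≡ other x z ⊎ k ≡ z
    other-only k xk with z F.≟ nbr₁ x | only-nbrs x k xk
    ... | yes refl | inj₁ k≡z = inj₂ k≡z
    ... | yes refl | inj₂ k≡₂ = inj₁ k≡₂
    ... | no z≢₁ | inj₁ k≡₁ = inj₁ k≡₁
    ... | no z≢₁ | inj₂ k≡₂ with only-nbrs x z xz
    ...   | inj₁ z≡₁ = ⊥-elim (z≢₁ z≡₁)
    ...   | inj₂ z≡₂ = inj₂ (trans k≡₂ (sym z≡₂))

    other≢ : other x z ≢ z
    other≢ with z F.≟ nbr₁ x
    ... | yes z≡₁ = λ e → nbr₁≢nbr₂ x (trans (sym z≡₁) (sym e))
    ... | no z≢₁ = λ e → z≢₁ (sym e)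

    other-other : other x (other x z) ≡ z
    other-other with only-nbrs x z xz
    ... | inj₁ refl = trans (cong (other x) (other-nbr₁ x)) (other-nbr₂ x)
    ... | inj₂ refl = trans (cong (other x) (other-nbr₂ x)) (other-nbr₁ x)

  walkFrom : Fin n → Fin n → ℕ → Fin n
  walkFrom v y zero          = v
  walkFrom v y (suc zero)    = y
  walkFrom v y (suc (suc k)) = other (walkFrom v y (suc k)) (walkFrom v y k)

  module Walk (v y : Fin n) (vy : adj v y ≡ true) where

    q : ℕ → Fin n
    q = walkFrom v y

    q-forward : ∀ a → adj (q a) (q (suc a)) ≡ true
    q-forward zero    = vy
    q-forward (suc a) = adj-other (q (suc a)) (q a)

    q-backward : ∀ a → adj (q (suc a)) (q a) ≡ true
    q-backward a = trans (adj-sym _ _) (q-forward a)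

    unrolling : Unrolling adj q
    unrolling = record
      { forward      = q-forward
      ; backward     = q-backward
      ; neighbours   = λ a → other-only (q (suc a)) (q a) (q-backward a)
      ; no-backtrack = λ a → other≢ (q (suc a)) (q a) (q-backward a)
      }

    -- A walk that never backtracks is determined by any two consecutive vertices.
    RepeatsAt : ℕ → ℕ → Set
    RepeatsAt P i = q i ≡ q (i + P) × q (suc i) ≡ q (suc i + P)

    repeats-forward : ∀ P i → RepeatsAt P i → RepeatsAt P (suc i)
    repeats-forward P i (e₁ , e₂) = e₂ , cong₂ other e₂ e₁

    repeats-backward : ∀ P i → RepeatsAt P (suc i) → RepeatsAt P i
    repeats-backward P i (e₁ , e₂) =
      trans (sym (other-other (q (suc i)) (q i) (q-backward i)))
            (trans (cong₂ other e₁ e₂) (other-other (q (suc (i + P))) (q (i + P)) (q-backward (i + P)))) , e₁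

    repeats-from-start : ∀ P i → RepeatsAt P i → RepeatsAt P 0
    repeats-from-start P zero    r = r
    repeats-from-start P (suc i) r = repeats-from-start P i (repeats-backward P i r)

    periodic : ∀ P → RepeatsAt P 0 → ∀ k → q (k + P) ≡ q k
    periodic P r k = sym (proj₁ (repeats-everywhere k))
      where
      repeats-everywhere : ∀ k → RepeatsAt P k
      repeats-everywhere zero    = r
      repeats-everywhere (suc k) = repeats-forward P k (repeats-everywhere k)

    period : ∃ λ P → 1 ≤ P × RepeatsAt P 0
    period with pigeonhole-pair q (q ∘ suc)
    ... | i , j , i<j , e₁ , e₂ = P , m<n⇒0<n∸m i<j ,
          repeats-from-start P i (trans e₁ (cong q (sym i+P≡j)) , trans e₂ (cong (q ∘ suc) (sym i+P≡j)))
      where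
      P = j ∸ i
      i+P≡j : i + P ≡ j
      i+P≡j = m+[n∸m]≡n (<⇒≤ i<j)

    returns : ∀ P → RepeatsAt P 0 → ∀ t → q (t * P) ≡ v
    returns P r zero    = refl
    returns P r (suc t) = trans (cong q (+-comm P (t * P))) (trans (periodic P r (t * P)) (returns P r t))

  -- The walk around the cycle through v is periodic, so it unrolls at a point
  -- as far from 0 as needed.
  lineWalks≤walks-everywhere : ∀ h v → lineWalks h h h ≤ walks adj h v v
  lineWalks≤walks-everywhere h v with Walk.period v (nbr₁ v) (adj-nbr₁ v)
  ... | P , 1≤P , r = subst (_≤ walks adj h v v) (lineWalks-diag h (h * P) h≤hP)
    (subst (λ z → lineWalks h (h * P) (h * P) ≤ walks adj h z z) (Walk.returns v (nbr₁ v) (adj-nbr₁ v) P r h)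
      (Unrolled.lineWalks≤walks (Walk.unrolling v (nbr₁ v) (adj-nbr₁ v)) h (h * P) h≤hP))
    where
    h≤hP : h ≤ h * P
    h≤hP = subst (_≤ h * P) (*-identityʳ h) (*-monoʳ-≤ h 1≤P)

module CycleFromWalkCounts (m : ℕ) {adj : Adjacency (3 + m)} (simple : IsSimpleGraph adj)
  (counts : DegreeTwo.HasCycleWalkCounts (3 + m) adj) where

  open import Data.Nat hiding (_+_)
  open import Data.Nat.Properties
  open import Data.Nat.DivMod
  open import Data.Fin as F using (Fin; toℕ)
  import Data.Fin.Properties as FP
  open import Data.Bool using (Bool; true)
  open import Data.Sum using (inj₁; inj₂)
  open import Data.Product using (_,_; proj₁; proj₂)
  open import Relation.Nullary using (yes; no)
  open import Relation.Binary.PropositionalEquality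
  open import Relation.Binary.Definitions using (tri<; tri≈; tri>)
  open import Data.Empty using (⊥-elim)
  open import Function using (_∘_)
  open import Function.Bundles using (mk⇔)
  open import Data.Bool.Properties using (⇔→≡)
  open IsSimpleGraph simple
  open KroneckerSums
  open WalkCounts using (walks; closedWalks)
  open LineWalks
  open Unrollings
  open CycleArithmetic m
  open CycleLabellings m
  open FinFacts

  R : DegreeTwo.TwoRegular adj
  R = DegreeTwo.twoRegular m simple counts

  open NonBacktrackingWalks simple R

  module Around (v₀ y : Fin N) (v₀y : adj v₀ y ≡ true) where
    open Walk v₀ y v₀y public
    open Unrolling unrolling using (no-backtrack)

    -- A repetition q i = q j with j − i = L < N would give q j one more closed
    -- walk of length L than every other vertex, exceeding the count of C_N.
    no-short-return : ∀ i j → i < j → j < N → q i ≢ q j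
    no-short-return i j i<j j<N qi≡qj = <-irrefl refl (≤-trans too-many (≤-reflexive (counts L L<N)))
      where
      L = j ∸ i
      i+L≡j : i + L ≡ j
      i+L≡j = m+[n∸m]≡n (<⇒≤ i<j)
      L<N : L < N
      L<N = ≤-<-trans (m∸n≤m j i) j<N
      L≤j : L ≤ j
      L≤j = m∸n≤m j i
      Z = lineWalks L L L
      at-least : ∀ v → Z + δ v (q j) ≤ walks adj L v v
      at-least v with v F.≟ q j
      ... | no _     = ≤-trans (≤-reflexive (+-identityʳ Z)) (lineWalks≤walks-everywhere L v)
      ... | yes refl = ≤-trans
        (+-mono-≤ (≤-reflexive (sym (lineWalks-diag L j L≤j))) (subst (λ z → 1 ≤ lineWalks L z i) i+L≡j (lineWalks-descend L i)))
        (Unrolled.lineWalks+return≤walks unrolling L j i L≤j (λ i≡j → <-irrefl i≡j i<j) (≤-trans (<⇒≤ i<j) (m≤m+n j L)) qi≡qj)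
      too-many : suc (N * Z) ≤ closedWalks adj L
      too-many = subst (_≤ closedWalks adj L)
        (trans (∑-distrib-+ (λ _ → Z) (λ v → δ v (q j))) (trans (cong₂ _+_ (sum-const N Z) (sum-δ≡1 (q j))) (+-comm (N * Z) 1)))
        (sum-mono at-least)

    q-injective : ∀ a b → a < N → b < N → q a ≡ q b → a ≡ b
    q-injective a b a<N b<N e with <-cmp a b
    ... | tri< a<b _ _ = ⊥-elim (no-short-return a b a<b b<N e)
    ... | tri≈ _ a≡b _ = a≡b
    ... | tri> _ _ b<a = ⊥-elim (no-short-return b a b<a a<N (sym e))

    vertex : Fin N → Fin N
    vertex i = q (toℕ i)

    vertex-injective : ∀ {i j} → vertex i ≡ vertex j → i ≡ j
    vertex-injective {i} {j} e = FP.toℕ-injective (q-injective (toℕ i) (toℕ j) (FP.toℕ<n i) (FP.toℕ<n j) e)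

    -- q N = q k for some k < N. For k > 0 the neighbour q (N − 1) of q k is q (k ± 1), so
    -- injectivity below N leaves k = N − 1 (a loop) or k = N − 2 (a backtrack).
    q-N : q N ≡ v₀
    q-N with injective⇒surjective vertex vertex-injective (q N)
    ... | k , qk≡qN = closes (toℕ k) (FP.toℕ<n k) qk≡qN
      where
      closes : ∀ k → k < N → q k ≡ q N → q N ≡ v₀
      closes zero    _   e = sym e
      closes (suc k) k<N e with k ≟ suc m
      ... | yes refl with () ← trans (sym (trans (cong (adj (q (2 + m))) e) (q-forward (2 + m)))) (irrefl (q (2 + m)))
      ... | no k≢ with other-only (q (suc k)) (q k) (q-backward k) (q (2 + m)) (trans (cong (λ z → adj z (q (2 + m))) e) (q-backward (2 + m)))
      ...   | inj₂ e₂ = ⊥-elim (<-irrefl refl (subst (λ z → suc z < N) (sym (q-injective (2 + m) k ≤-refl (<-trans (n<1+n k) k<N) e₂)) k<N))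
      ...   | inj₁ e₂ = ⊥-elim (no-backtrack (suc m) (trans (sym e) (cong (q ∘ suc) k≡m)))
        where
        k≡m : k ≡ m
        k≡m = suc-injective (suc-injective (sym (q-injective (2 + m) (suc (suc k)) ≤-refl
                (s≤s (s≤s (≤∧≢⇒< (≤-pred (≤-pred k<N)) k≢))) e₂)))

    q-N∸1 : q (2 + m) ≡ other v₀ y
    q-N∸1 with other-only v₀ y v₀y (q (2 + m)) (trans (cong (λ z → adj z (q (2 + m))) (sym q-N)) (q-backward (2 + m)))
    ... | inj₁ e = e
    ... | inj₂ e with () ← q-injective (2 + m) 1 ≤-refl (s≤s (s≤s z≤n)) e

    q-periodic : ∀ k → q (k + N) ≡ q k
    q-periodic = periodic N (sym q-N , sym (trans (cong₂ other q-N q-N∸1) (other-other v₀ y v₀y)))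

    q-% : ∀ x → q (x % N) ≡ q x
    q-% x = trans (sym (q-+multiple (x % N) (x / N))) (cong q (sym (m≡m%n+[m/n]*n x N)))
      where
      q-+multiple : ∀ r t → q (r + t * N) ≡ q r
      q-+multiple r zero    = cong q (+-identityʳ r)
      q-+multiple r (suc t) = trans (cong q (trans (cong (r +_) (+-comm N (t * N))) (sym (+-assoc r (t * N) N))))
                                    (trans (q-periodic (r + t * N)) (q-+multiple r t))

    q-%-injective : ∀ x j → j < N → q x ≡ q j → x % N ≡ j
    q-%-injective x j j<N e = q-injective (x % N) j (m%n<n x N) j<N (trans (q-% x) e)

    labelling : CycleLabelling adj
    labelling = record
      { vertex          = vertex
      ; position        = position
      ; vertex-position = λ v → proj₂ (injective⇒surjective vertex vertex-injective v)
      ; position-vertex = λ i → vertex-injective (proj₂ (injective⇒surjective vertex vertex-injective (vertex i)))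
      ; adj-vertex      = λ i j → ⇔→≡ {z = true} (mk⇔ (to-cycle i j) (from-cycle i j))
      }
      where
      position : Fin N → Fin N
      position v = proj₁ (injective⇒surjective vertex vertex-injective v)
      to-cycle : ∀ i j → adj (vertex i) (vertex j) ≡ true → cycleAdj N i j ≡ true
      to-cycle i j e with Unrolling.neighbours unrolling (toℕ i + (2 + m)) (vertex j)
                            (trans (cong (λ z → adj z (vertex j)) (trans (cong q (sym (+-suc (toℕ i) (2 + m)))) (q-periodic (toℕ i)))) e)
      ... | inj₁ e₁ = cycleAdj-next i j (sym (q-%-injective (suc (toℕ i)) (toℕ j) (FP.toℕ<n j)
                        (sym (trans e₁ (trans (cong q (cong suc (sym (+-suc (toℕ i) (2 + m))))) (q-periodic (suc (toℕ i))))))))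
      ... | inj₂ e₁ = cycleAdj-prev i j (sym (begin
            suc (toℕ j) % N                      ≡⟨ cong (λ z → suc z % N) (sym (q-%-injective (toℕ i + (2 + m)) (toℕ j) (FP.toℕ<n j) (sym e₁))) ⟩
            suc ((toℕ i + (2 + m)) % N) % N      ≡⟨ suc-% (toℕ i + (2 + m)) ⟩
            suc (toℕ i + (2 + m)) % N            ≡⟨ cong (_% N) (sym (+-suc (toℕ i) (2 + m))) ⟩
            (toℕ i + N) % N                      ≡⟨ [m+n]%n≡m%n (toℕ i) N ⟩
            toℕ i % N                            ≡⟨ %N-id (FP.toℕ<n i) ⟩
            toℕ i                                ∎))
        where open ≡-Reasoning
      from-cycle : ∀ i j → cycleAdj N i j ≡ true → adj (vertex i) (vertex j) ≡ true
      from-cycle i j e with cycleAdj-elim i j e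
      ... | inj₁ e₁ = trans (cong (adj (vertex i)) (trans (cong q e₁) (q-% (suc (toℕ i))))) (q-forward (toℕ i))
      ... | inj₂ e₁ = trans (cong (λ z → adj z (vertex j)) (trans (cong q e₁) (q-% (suc (toℕ j))))) (q-backward (toℕ j))

    at-labelling : ∀ a → Labelled.at labelling a ≡ q a
    at-labelling a = trans (cong q (toℕ-pos a)) (q-% a)

  v₀ : Fin N
  v₀ = F.zero

  labelling₁ labelling₂ : CycleLabelling adj
  labelling₁ = Around.labelling v₀ (nbr₁ v₀) (adj-nbr₁ v₀)
  labelling₂ = Around.labelling v₀ (nbr₂ v₀) (adj-nbr₂ v₀)

  orientations-reversed : ∀ k → k ≤ N → Labelled.at labelling₂ k ≡ Labelled.at labelling₁ (N ∸ k)
  orientations-reversed k k≤N =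
    trans (Around.at-labelling v₀ (nbr₂ v₀) (adj-nbr₂ v₀) k)
      (trans (reversed k k≤N) (sym (Around.at-labelling v₀ (nbr₁ v₀) (adj-nbr₁ v₀) (N ∸ k))))
    where
    q₁ = walkFrom v₀ (nbr₁ v₀)
    q₂ = walkFrom v₀ (nbr₂ v₀)
    module Around₁ = Around v₀ (nbr₁ v₀) (adj-nbr₁ v₀)
    reversed : ∀ k → k ≤ N → q₂ k ≡ q₁ (N ∸ k)
    reversed zero          _   = sym Around₁.q-N
    reversed (suc zero)    _   = sym (trans Around₁.q-N∸1 (other-nbr₁ v₀))
    reversed (suc (suc k)) k<N = begin
      other (q₂ (suc k)) (q₂ k)              ≡⟨ cong₂ other (reversed (suc k) (<⇒≤ k<N)) (reversed k (<⇒≤ (<⇒≤ k<N))) ⟩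
      other (q₁ (N ∸ suc k)) (q₁ (N ∸ k))    ≡⟨ cong₂ (λ a b → other (q₁ a) (q₁ b)) N∸k-1 N∸k ⟩
      other (q₁ (suc j)) (q₁ (suc (suc j)))  ≡⟨ other-other (q₁ (suc j)) (q₁ j) (Around₁.q-backward j) ⟩
      q₁ j                                   ∎
      where
      open ≡-Reasoning
      j = N ∸ suc (suc k)
      N∸k-1 : N ∸ suc k ≡ suc j
      N∸k-1 = +-∸-assoc 1 k<N
      N∸k : N ∸ k ≡ suc (suc j)
      N∸k = trans (+-∸-assoc 1 (<⇒≤ k<N)) (cong suc N∸k-1)

module Conjugacy {c ℓ : Level} (G : Group c ℓ) where

  open import Data.Product using (_,_)
  open import Relation.Binary.Bundles using (Setoid)
  open Group G renaming (Carrier to Elt)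
  open import Algebra.Properties.Group G
  open import Relation.Binary.Reasoning.Setoid setoid

  infix 4 _∼_
  _∼_ : Elt → Elt → Set (c Level.⊔ ℓ)
  _∼_ = _∼conj_ G

  ≈⇒∼ : ∀ {x y} → x ≈ y → x ∼ y
  ≈⇒∼ {x} {y} x≈y = ε , (begin
    (ε ∙ x) ∙ ε ⁻¹  ≈⟨ ∙-cong (identityˡ x) ε⁻¹≈ε ⟩
    x ∙ ε           ≈⟨ identityʳ x ⟩
    x               ≈⟨ x≈y ⟩
    y               ∎)

  ∼-refl : ∀ {x} → x ∼ x
  ∼-refl = ≈⇒∼ refl

  ∼-sym : ∀ {x y} → x ∼ y → y ∼ x
  ∼-sym {x} {y} (t , txt⁻¹≈y) = t ⁻¹ , (begin
    (t ⁻¹ ∙ y) ∙ t ⁻¹ ⁻¹             ≈⟨ ∙-cong (∙-congˡ (sym txt⁻¹≈y)) (⁻¹-involutive t) ⟩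
    (t ⁻¹ ∙ ((t ∙ x) ∙ t ⁻¹)) ∙ t    ≈⟨ ∙-congʳ (∙-congˡ (assoc t x (t ⁻¹))) ⟩
    (t ⁻¹ ∙ (t ∙ (x ∙ t ⁻¹))) ∙ t    ≈⟨ ∙-congʳ (\\-leftDividesʳ t (x ∙ t ⁻¹)) ⟩
    (x ∙ t ⁻¹) ∙ t                   ≈⟨ //-rightDividesˡ t x ⟩
    x                                ∎)

  ∼-trans : ∀ {x y z} → x ∼ y → y ∼ z → x ∼ z
  ∼-trans {x} {y} {z} (t , x→y) (s , y→z) = s ∙ t , (begin
    ((s ∙ t) ∙ x) ∙ (s ∙ t) ⁻¹        ≈⟨ ∙-cong (assoc s t x) (⁻¹-anti-homo-∙ s t) ⟩
    (s ∙ (t ∙ x)) ∙ (t ⁻¹ ∙ s ⁻¹)     ≈⟨ assoc s (t ∙ x) (t ⁻¹ ∙ s ⁻¹) ⟩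
    s ∙ ((t ∙ x) ∙ (t ⁻¹ ∙ s ⁻¹))     ≈⟨ ∙-congˡ (sym (assoc (t ∙ x) (t ⁻¹) (s ⁻¹))) ⟩
    s ∙ (((t ∙ x) ∙ t ⁻¹) ∙ s ⁻¹)     ≈⟨ ∙-congˡ (∙-congʳ x→y) ⟩
    s ∙ (y ∙ s ⁻¹)                    ≈⟨ sym (assoc s y (s ⁻¹)) ⟩
    (s ∙ y) ∙ s ⁻¹                    ≈⟨ y→z ⟩
    z                                 ∎)

  ∼-respʳ-≈ : ∀ {x y z} → x ∼ y → y ≈ z → x ∼ z
  ∼-respʳ-≈ (t , x→y) y≈z = t , trans x→y y≈z

  ∼-respˡ-≈ : ∀ {x y z} → x ≈ y → y ∼ z → x ∼ z
  ∼-respˡ-≈ x≈y = ∼-trans (≈⇒∼ x≈y)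

  ∼-⁻¹ : ∀ {x y} → x ∼ y → x ⁻¹ ∼ y ⁻¹
  ∼-⁻¹ {x} {y} (t , x→y) = t , (begin
    (t ∙ x ⁻¹) ∙ t ⁻¹          ≈⟨ assoc t (x ⁻¹) (t ⁻¹) ⟩
    t ∙ (x ⁻¹ ∙ t ⁻¹)          ≈⟨ ∙-cong (sym (⁻¹-involutive t)) (sym (⁻¹-anti-homo-∙ t x)) ⟩
    t ⁻¹ ⁻¹ ∙ (t ∙ x) ⁻¹       ≈⟨ sym (⁻¹-anti-homo-∙ (t ∙ x) (t ⁻¹)) ⟩
    ((t ∙ x) ∙ t ⁻¹) ⁻¹        ≈⟨ ⁻¹-cong x→y ⟩
    y ⁻¹                       ∎)

  ⁻¹∼⇒∼⁻¹ : ∀ {x y} → x ⁻¹ ∼ y → x ∼ y ⁻¹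
  ⁻¹∼⇒∼⁻¹ {x} x⁻¹∼y = ∼-respˡ-≈ (sym (⁻¹-involutive x)) (∼-⁻¹ x⁻¹∼y)

  conjugacy : Setoid c (c Level.⊔ ℓ)
  conjugacy = record
    { Carrier       = Elt
    ; _≈_           = _∼_
    ; isEquivalence = record { refl = ∼-refl ; sym = ∼-sym ; trans = ∼-trans }
    }

module CycleGains {c ℓ : Level} (G : Group c ℓ) (m : ℕ) where

  open import Data.Nat as ℕ using (zero; suc; _≤_; s≤s)
  import Data.Nat.Properties as ℕP
  open import Data.Fin as F using (Fin; toℕ)
  import Data.Fin.Properties as FP
  open import Data.Nat.DivMod using (n%n≡0)
  open import Data.Bool using (true)
  open import Data.List using (allFin; map)
  open import Data.List.Relation.Unary.Any using (here)
  open import Data.List.Membership.Propositional using (_∈_; find; lose)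
  open import Data.List.Membership.Propositional.Properties using (∈-concatMap⁺; ∈-concatMap⁻; ∈-map⁺; ∈-map⁻; ∈-allFin)
  open import Data.Sum using (_⊎_; inj₁; inj₂)
  open import Data.Product using (_×_; _,_; ∃)
  open import Relation.Nullary using (yes; no)
  open import Data.Empty using (⊥-elim)
  open Group G renaming (Carrier to Elt)
  open import Algebra.Properties.Group G
  open import Relation.Binary.Reasoning.Setoid setoid
  open Conjugacy G
  open Unrollings using (module Unrolling)
  open CycleArithmetic m
  open CycleLabellings m

  ∈-⊗⁻ : ∀ (a b : ℕG G) x → x ∈ _⊗_ G a b → ∃ λ s → ∃ λ t → s ∈ a × t ∈ b × x ≡ s ∙ t
  ∈-⊗⁻ a b x x∈ with find (∈-concatMap⁻ (λ s → map (s ∙_) b) {xs = a} x∈)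
  ... | s , s∈a , x∈sb with ∈-map⁻ (s ∙_) x∈sb
  ...   | t , t∈b , x≡st = s , t , s∈a , t∈b , x≡st

  ∈-⊗⁺ : ∀ (a b : ℕG G) {s t} → s ∈ a → t ∈ b → s ∙ t ∈ _⊗_ G a b
  ∈-⊗⁺ a b {s} s∈ t∈ = ∈-concatMap⁺ (λ s → map (s ∙_) b) {xs = a} (lose s∈ (∈-map⁺ (s ∙_) t∈))

  ∈-idMat : ∀ {i j : Fin N} {x} → x ∈ idMat G i j → i ≡ j × x ≡ ε
  ∈-idMat {i} {j} x∈ with i F.≟ j
  ∈-idMat x∈ | yes i≡j with here x≡ε ← x∈ = i≡j , x≡ε

  ∈-trace : ∀ {B : Mat G N} {x} → x ∈ Tr G B → ∃ λ v → x ∈ B v v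
  ∈-trace {B} x∈ with find (∈-concatMap⁻ (λ i → B i i) {xs = allFin N} x∈)
  ... | v , _ , x∈v = v , x∈v

  ∈-trace⁺ : ∀ {B : Mat G N} {x} v → x ∈ B v v → x ∈ Tr G B
  ∈-trace⁺ {B} v x∈ = ∈-concatMap⁺ (λ i → B i i) {xs = allFin N} (lose (∈-allFin v) x∈)

  module _ (Γ : GainGraph G N) where

    ∈-adjMat : ∀ u k {s} → s ∈ adjMat G Γ u k → adj Γ u k ≡ true × s ≡ ψ Γ u k
    ∈-adjMat u k s∈ with adj Γ u k
    ∈-adjMat u k (here s≡ψ) | true = ≡.refl , s≡ψ

    ∈-power-suc : ∀ h i j {x} → x ∈ (_^ᴹ_ G (adjMat G Γ) (suc h)) i j →
      ∃ λ k → ∃ λ s → ∃ λ t → s ∈ adjMat G Γ i k × t ∈ (_^ᴹ_ G (adjMat G Γ) h) k j × x ≡ s ∙ t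
    ∈-power-suc h i j {x} x∈ with find (∈-concatMap⁻ (λ k → _⊗_ G (adjMat G Γ i k) ((_^ᴹ_ G (adjMat G Γ) h) k j)) {xs = allFin N} x∈)
    ... | k , _ , x∈k with ∈-⊗⁻ (adjMat G Γ i k) _ x x∈k
    ...   | s , t , s∈ , t∈ , x≡st = k , s , t , s∈ , t∈ , x≡st

    ∈-power-suc⁺ : ∀ h i k j {s t} → s ∈ adjMat G Γ i k → t ∈ (_^ᴹ_ G (adjMat G Γ) h) k j →
      s ∙ t ∈ (_^ᴹ_ G (adjMat G Γ) (suc h)) i j
    ∈-power-suc⁺ h i k j s∈ t∈ = ∈-concatMap⁺ (λ k → _⊗_ G (adjMat G Γ i k) ((_^ᴹ_ G (adjMat G Γ) h) k j)) {xs = allFin N}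
      (lose (∈-allFin k) (∈-⊗⁺ (adjMat G Γ i k) _ s∈ t∈))

  private
    absorb : ∀ w a x → w ∙ ((a ∙ w) ⁻¹ ∙ x) ≈ a ⁻¹ ∙ x
    absorb w a x = begin
      w ∙ ((a ∙ w) ⁻¹ ∙ x)          ≈⟨ ∙-congˡ (∙-congʳ (⁻¹-anti-homo-∙ a w)) ⟩
      w ∙ ((w ⁻¹ ∙ a ⁻¹) ∙ x)       ≈⟨ ∙-congˡ (assoc (w ⁻¹) (a ⁻¹) x) ⟩
      w ∙ (w ⁻¹ ∙ (a ⁻¹ ∙ x))       ≈⟨ \\-leftDividesˡ w (a ⁻¹ ∙ x) ⟩
      a ⁻¹ ∙ x                      ∎

    absorb⁻¹ : ∀ w a x → w ⁻¹ ∙ (a ⁻¹ ∙ x) ≈ (a ∙ w) ⁻¹ ∙ x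
    absorb⁻¹ w a x = begin
      w ⁻¹ ∙ (a ⁻¹ ∙ x)             ≈⟨ sym (assoc (w ⁻¹) (a ⁻¹) x) ⟩
      (w ⁻¹ ∙ a ⁻¹) ∙ x             ≈⟨ ∙-congʳ (sym (⁻¹-anti-homo-∙ a w)) ⟩
      (a ∙ w) ⁻¹ ∙ x                ∎

  module Along (Γ : GainGraph G N) (L : CycleLabelling (adj Γ)) where
    open Labelled L
    open CycleLabelling L using (vertex; position)
    open Unrolling unrolling

    Aʰ : ℕ → Mat G N
    Aʰ h = _^ᴹ_ G (adjMat G Γ) h

    stepGain : ℕ → Elt
    stepGain a = ψ Γ (at a) (at (suc a))

    potential : ℕ → Elt
    potential zero    = ε
    potential (suc a) = potential a ∙ stepGain a

    cycleGain : Elt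
    cycleGain = potential N

    -- Each entry of Aʰ from at a is the gain of a walk that lifts to the line,
    -- and the gain of a line walk from a to b is potential a ⁻¹ ∙ potential b.
    walk-gain : ∀ h a w x → h ≤ a → x ∈ Aʰ h (at a) w →
      ∃ λ b → b ≤ a + h × a ≤ b + h × at b ≡ w × x ≈ potential a ⁻¹ ∙ potential b
    walk-gain zero a w x _ x∈ with ∈-idMat x∈
    ... | at-a≡w , ≡.refl = a , ℕP.m≤m+n a 0 , ℕP.m≤m+n a 0 , at-a≡w , sym (inverseˡ (potential a))
    walk-gain (suc h) (suc a) w x (s≤s h≤a) x∈ with ∈-power-suc Γ h (at (suc a)) w x∈
    ... | k , s , t , s∈ , t∈ , ≡.refl with ∈-adjMat Γ (at (suc a)) k s∈
    ...   | adj-k , ≡.refl with neighbours a k adj-k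
    ...     | inj₁ ≡.refl with walk-gain h (suc (suc a)) w t (ℕP.m≤n⇒m≤1+n (ℕP.m≤n⇒m≤1+n h≤a)) t∈
    ...       | b , b≤ , ≤b , at-b , t≈ = b , ≡.subst (b ≤_) (≡.sym (ℕP.+-suc (suc a) h)) b≤ ,
                  ≡.subst (suc a ≤_) (≡.sym (ℕP.+-suc b h)) (ℕP.≤-trans (ℕP.n≤1+n (suc a)) (ℕP.m≤n⇒m≤1+n ≤b)) , at-b ,
                  (begin
                    stepGain (suc a) ∙ t                                    ≈⟨ ∙-congˡ t≈ ⟩
                    stepGain (suc a) ∙ (potential (suc (suc a)) ⁻¹ ∙ potential b)  ≈⟨ absorb (stepGain (suc a)) (potential (suc a)) (potential b) ⟩
                    potential (suc a) ⁻¹ ∙ potential b                      ∎)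
    walk-gain (suc h) (suc a) w x (s≤s h≤a) x∈ | k , s , t , s∈ , t∈ , ≡.refl | adj-k , ≡.refl | inj₂ ≡.refl
      with walk-gain h a w t h≤a t∈
    ...       | b , b≤ , ≤b , at-b , t≈ = b , ℕP.≤-trans b≤ (ℕP.+-mono-≤ (ℕP.n≤1+n a) (ℕP.n≤1+n h)) ,
                  ≡.subst (suc a ≤_) (≡.sym (ℕP.+-suc b h)) (s≤s ≤b) , at-b ,
                  (begin
                    ψ Γ (at (suc a)) (at a) ∙ t                    ≈⟨ ∙-cong (ψ-inv Γ (at a) (at (suc a)) (forward a)) t≈ ⟩
                    stepGain a ⁻¹ ∙ (potential a ⁻¹ ∙ potential b)  ≈⟨ absorb⁻¹ (stepGain a) (potential a) (potential b) ⟩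
                    potential (suc a) ⁻¹ ∙ potential b             ∎)

    straight-walk : ∀ h a → ∃ λ x → x ∈ Aʰ h (at a) (at (a + h)) × x ≈ potential a ⁻¹ ∙ potential (a + h)
    straight-walk zero a = ε , ε∈ , ≡.subst (λ z → ε ≈ potential a ⁻¹ ∙ potential z) (≡.sym (ℕP.+-identityʳ a)) (sym (inverseˡ (potential a)))
      where
      ε∈ : ε ∈ Aʰ zero (at a) (at (a + zero))
      ε∈ rewrite ℕP.+-identityʳ a with at a F.≟ at a
      ... | yes _ = here ≡.refl
      ... | no ≢ = ⊥-elim (≢ ≡.refl)
    straight-walk (suc h) a with straight-walk h (suc a)
    ... | t , t∈ , t≈ = stepGain a ∙ t , ∈-power-suc⁺ Γ h (at a) (at (suc a)) (at (a + suc h)) s∈ (≡.subst (λ z → t ∈ Aʰ h (at (suc a)) z) at-end t∈) , (begin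
      stepGain a ∙ t                                          ≈⟨ ∙-congˡ t≈ ⟩
      stepGain a ∙ (potential (suc a) ⁻¹ ∙ potential (suc a + h))  ≈⟨ absorb (stepGain a) (potential a) _ ⟩
      potential a ⁻¹ ∙ potential (suc a + h)                  ≡⟨ ≡.cong (λ z → potential a ⁻¹ ∙ potential z) (≡.sym (ℕP.+-suc a h)) ⟩
      potential a ⁻¹ ∙ potential (a + suc h)                  ∎)
      where
      at-end : at (suc a + h) ≡ at (a + suc h)
      at-end = ≡.cong at (≡.sym (ℕP.+-suc a h))
      s∈ : stepGain a ∈ adjMat G Γ (at a) (at (suc a))
      s∈ rewrite forward a = here ≡.refl

    at-+N : ∀ a → at (a + N) ≡ at a
    at-+N a = ≡.cong vertex (pos-+N a)

    potential-around : ∀ a → potential a ⁻¹ ∙ potential (a + N) ∼ cycleGain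
    potential-around zero = ≈⇒∼ (trans (∙-congʳ ε⁻¹≈ε) (identityˡ _))
    potential-around (suc a) = ∼-trans (∼-sym (stepGain a ⁻¹ , (begin
      (stepGain a ⁻¹ ∙ (potential a ⁻¹ ∙ potential (a + N))) ∙ stepGain a ⁻¹ ⁻¹
        ≈⟨ ∙-cong (absorb⁻¹ (stepGain a) (potential a) (potential (a + N))) (⁻¹-involutive (stepGain a)) ⟩
      (potential (suc a) ⁻¹ ∙ potential (a + N)) ∙ stepGain a
        ≈⟨ assoc (potential (suc a) ⁻¹) (potential (a + N)) (stepGain a) ⟩
      potential (suc a) ⁻¹ ∙ (potential (a + N) ∙ stepGain a)
        ≡⟨ ≡.cong (λ w → potential (suc a) ⁻¹ ∙ (potential (a + N) ∙ w)) (≡.sym (≡.cong₂ (ψ Γ) (at-+N a) (at-+N (suc a)))) ⟩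
      potential (suc a) ⁻¹ ∙ potential (suc a + N) ∎))) (potential-around a)

    -- A closed walk of length N from at a ends at at b with |a − b| ∈ {0, N}:
    -- it either does not wind (gain ε) or winds once in either direction.
    trace-gain-classes : ∀ x → x ∈ Tr G (Aʰ N) → x ∼ ε ⊎ x ∼ cycleGain ⊎ x ∼ cycleGain ⁻¹
    trace-gain-classes x x∈ with ∈-trace {B = Aʰ N} x∈
    ... | v , x∈v with walk-gain N a (at a) x N≤a (≡.subst (λ z → x ∈ Aʰ N z z) (≡.sym (at-anchor v)) x∈v)
      where
      a = anchor v
      N≤a : N ≤ a
      N≤a = ℕP.m≤n+m N (toℕ (position v))
    ... | b , b≤ , ≤b , at-b , x≈ with ℕP.≤-total (anchor v) b
    ...   | inj₁ a≤b with b ℕP.<? anchor v + N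
    ...     | yes b<a+N = inj₁ (≈⇒∼ (trans x≈ (trans (∙-congˡ (reflexive (≡.cong potential (≡.sym a≡b)))) (inverseˡ _))))
      where
      a≡b : anchor v ≡ b
      a≡b = pos-injective-window (anchor v) b a≤b b<a+N (≡.sym (vertex-injective at-b))
    ...     | no b≮a+N = inj₂ (inj₁ (∼-respˡ-≈ (trans x≈ (∙-congˡ (reflexive (≡.cong potential (ℕP.≤-antisym b≤ (ℕP.≮⇒≥ b≮a+N))))))
                                       (potential-around (anchor v))))
    trace-gain-classes x x∈ | v , x∈v | b , b≤ , ≤b , at-b , x≈ | inj₂ b≤a with anchor v ℕP.<? b + N
    ...     | yes a<b+N = inj₁ (≈⇒∼ (trans x≈ (trans (∙-congˡ (reflexive (≡.cong potential b≡a))) (inverseˡ _))))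
      where
      b≡a : b ≡ anchor v
      b≡a = pos-injective-window b (anchor v) b≤a a<b+N (vertex-injective at-b)
    ...     | no a≮b+N = inj₂ (inj₂ (∼-respˡ-≈ (trans x≈ (trans (∙-congʳ (⁻¹-cong (reflexive (≡.cong potential a≡b+N)))) (swap-inverse (potential b) (potential (b + N)))))
                                       (∼-⁻¹ (potential-around b))))
      where
      a≡b+N : anchor v ≡ b + N
      a≡b+N = ℕP.≤-antisym ≤b (ℕP.≮⇒≥ a≮b+N)
      swap-inverse : ∀ p q → q ⁻¹ ∙ p ≈ (p ⁻¹ ∙ q) ⁻¹
      swap-inverse p q = sym (trans (⁻¹-anti-homo-∙ (p ⁻¹) q) (∙-congˡ (⁻¹-involutive p)))

    cycleGain∈trace : ∃ λ x → x ∈ Tr G (Aʰ N) × x ≈ cycleGain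
    cycleGain∈trace with straight-walk N 0
    ... | x , x∈ , x≈ = x , ∈-trace⁺ {B = Aʰ N} (at 0) (≡.subst (λ z → x ∈ Aʰ N (at 0) z) (at-+N 0) x∈) ,
                        trans x≈ (trans (∙-congʳ ε⁻¹≈ε) (identityˡ _))

  reversed-cycleGain : ∀ {Γ : GainGraph G N} (L₁ L₂ : CycleLabelling (adj Γ)) →
    (∀ k → k ≤ N → Labelled.at L₂ k ≡ Labelled.at L₁ (N ℕ.∸ k)) →
    Along.cycleGain Γ L₂ ≈ Along.cycleGain Γ L₁ ⁻¹
  reversed-cycleGain {Γ} L₁ L₂ reversed = begin
    potential₂ N                     ≈⟨ backwards N ℕP.≤-refl ⟩
    potential₁ N ⁻¹ ∙ potential₁ (N ℕ.∸ N)  ≡⟨ ≡.cong (λ k → potential₁ N ⁻¹ ∙ potential₁ k) (ℕP.n∸n≡0 N) ⟩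
    potential₁ N ⁻¹ ∙ ε              ≈⟨ identityʳ _ ⟩
    potential₁ N ⁻¹                  ∎
    where
    open Along Γ L₁ using () renaming (potential to potential₁; stepGain to stepGain₁)
    open Along Γ L₂ using () renaming (potential to potential₂; stepGain to stepGain₂)
    at₁ = Labelled.at L₁
    backwards : ∀ k → k ≤ N → potential₂ k ≈ potential₁ N ⁻¹ ∙ potential₁ (N ℕ.∸ k)
    backwards zero    _     = sym (inverseˡ _)
    backwards (suc k) 1+k≤N = begin
      potential₂ k ∙ stepGain₂ k
        ≈⟨ ∙-cong (backwards k (ℕP.<⇒≤ 1+k≤N)) (reflexive (≡.cong₂ (ψ Γ) (reversed k (ℕP.<⇒≤ 1+k≤N)) (reversed (suc k) 1+k≤N))) ⟩
      (potential₁ N ⁻¹ ∙ potential₁ (N ℕ.∸ k)) ∙ ψ Γ (at₁ (N ℕ.∸ k)) (at₁ j)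
        ≡⟨ ≡.cong (λ z → (potential₁ N ⁻¹ ∙ potential₁ z) ∙ ψ Γ (at₁ z) (at₁ j)) N∸k≡1+j ⟩
      (potential₁ N ⁻¹ ∙ (potential₁ j ∙ stepGain₁ j)) ∙ ψ Γ (at₁ (suc j)) (at₁ j)
        ≈⟨ ∙-congˡ (ψ-inv Γ (at₁ j) (at₁ (suc j)) (Unrolling.forward (Labelled.unrolling L₁) j)) ⟩
      (potential₁ N ⁻¹ ∙ (potential₁ j ∙ stepGain₁ j)) ∙ stepGain₁ j ⁻¹
        ≈⟨ ∙-congʳ (sym (assoc _ _ _)) ⟩
      ((potential₁ N ⁻¹ ∙ potential₁ j) ∙ stepGain₁ j) ∙ stepGain₁ j ⁻¹
        ≈⟨ //-rightDividesʳ (stepGain₁ j) _ ⟩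
      potential₁ N ⁻¹ ∙ potential₁ j ∎
      where
      j = N ℕ.∸ suc k
      N∸k≡1+j : N ℕ.∸ k ≡ suc j
      N∸k≡1+j = ℕP.+-∸-assoc 1 1+k≤N

  module Switching {Γ Γ′ : GainGraph G N} (L : CycleLabelling (adj Γ)) (L′ : CycleLabelling (adj Γ′))
    (t : Elt) (tgt⁻¹≈g′ : (t ∙ Along.cycleGain Γ L) ∙ t ⁻¹ ≈ Along.cycleGain Γ′ L′) where
    private
      module L  = CycleLabelling L
      module L′ = CycleLabelling L′
    open Along Γ L using (potential; stepGain; cycleGain)
    open Along Γ′ L′ using () renaming (potential to potential′; stepGain to stepGain′; cycleGain to cycleGain′)

    φ : Fin N → Fin N
    φ u = L′.vertex (L.position u)

    -- The switching carries every step gain of Γ to the corresponding one of Γ′,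
    -- and closes up around the cycle because t conjugates g to g′.
    Φ : ℕ → Elt
    Φ k = (potential k ⁻¹ ∙ t ⁻¹) ∙ potential′ k

    f : Fin N → Elt
    f u = Φ (toℕ (L.position u))

    Φ-step : ∀ k → stepGain′ k ≈ (Φ k ⁻¹ ∙ stepGain k) ∙ Φ (suc k)
    Φ-step k = sym (begin
      (((P ⁻¹ ∙ t ⁻¹) ∙ P′) ⁻¹ ∙ w) ∙ (((P ∙ w) ⁻¹ ∙ t ⁻¹) ∙ (P′ ∙ w′))
        ≈⟨ ∙-cong (∙-congʳ (⁻¹-anti-homo-∙ _ _)) (∙-congʳ (∙-congʳ (⁻¹-anti-homo-∙ P w))) ⟩
      ((P′ ⁻¹ ∙ (P ⁻¹ ∙ t ⁻¹) ⁻¹) ∙ w) ∙ (((w ⁻¹ ∙ P ⁻¹) ∙ t ⁻¹) ∙ (P′ ∙ w′))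
        ≈⟨ assoc _ _ _ ⟩
      (P′ ⁻¹ ∙ (P ⁻¹ ∙ t ⁻¹) ⁻¹) ∙ (w ∙ (((w ⁻¹ ∙ P ⁻¹) ∙ t ⁻¹) ∙ (P′ ∙ w′)))
        ≈⟨ ∙-congˡ (∙-congˡ (trans (∙-congʳ (assoc _ _ _)) (assoc _ _ _))) ⟩
      (P′ ⁻¹ ∙ (P ⁻¹ ∙ t ⁻¹) ⁻¹) ∙ (w ∙ (w ⁻¹ ∙ ((P ⁻¹ ∙ t ⁻¹) ∙ (P′ ∙ w′))))
        ≈⟨ ∙-congˡ (\\-leftDividesˡ w _) ⟩
      (P′ ⁻¹ ∙ (P ⁻¹ ∙ t ⁻¹) ⁻¹) ∙ ((P ⁻¹ ∙ t ⁻¹) ∙ (P′ ∙ w′))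
        ≈⟨ assoc _ _ _ ⟩
      P′ ⁻¹ ∙ ((P ⁻¹ ∙ t ⁻¹) ⁻¹ ∙ ((P ⁻¹ ∙ t ⁻¹) ∙ (P′ ∙ w′)))
        ≈⟨ ∙-congˡ (\\-leftDividesʳ _ _) ⟩
      P′ ⁻¹ ∙ (P′ ∙ w′)
        ≈⟨ \\-leftDividesʳ P′ w′ ⟩
      w′ ∎)
      where
      P = potential k
      P′ = potential′ k
      w = stepGain k
      w′ = stepGain′ k

    Φ-N : Φ N ≈ Φ 0
    Φ-N = begin
      (cycleGain ⁻¹ ∙ t ⁻¹) ∙ cycleGain′                 ≈⟨ ∙-congˡ (sym tgt⁻¹≈g′) ⟩
      (cycleGain ⁻¹ ∙ t ⁻¹) ∙ ((t ∙ cycleGain) ∙ t ⁻¹)   ≈⟨ ∙-congʳ (sym (⁻¹-anti-homo-∙ t cycleGain)) ⟩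
      (t ∙ cycleGain) ⁻¹ ∙ ((t ∙ cycleGain) ∙ t ⁻¹)      ≈⟨ \\-leftDividesʳ _ _ ⟩
      t ⁻¹                                               ≈⟨ sym (trans (∙-congʳ (∙-congʳ ε⁻¹≈ε)) (trans (identityʳ _) (identityˡ _))) ⟩
      (ε ⁻¹ ∙ t ⁻¹) ∙ ε                                  ∎

    forward-edge : ∀ i j → toℕ j ≡ suc (toℕ i) ℕ.% N →
      ψ Γ′ (L′.vertex i) (L′.vertex j) ≈ (Φ (toℕ i) ⁻¹ ∙ ψ Γ (L.vertex i) (L.vertex j)) ∙ Φ (toℕ j)
    forward-edge i j j-next = begin
      ψ Γ′ (L′.vertex i) (L′.vertex j)                       ≡⟨ ≡.sym (≡.cong₂ (λ a b → ψ Γ′ (L′.vertex a) (L′.vertex b)) pos-k pos-1+k) ⟩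
      stepGain′ k                                            ≈⟨ Φ-step k ⟩
      (Φ k ⁻¹ ∙ stepGain k) ∙ Φ (suc k)                      ≡⟨ ≡.cong₂ (λ a b → (Φ k ⁻¹ ∙ ψ Γ (L.vertex a) (L.vertex b)) ∙ Φ (suc k)) pos-k pos-1+k ⟩
      (Φ k ⁻¹ ∙ ψ Γ (L.vertex i) (L.vertex j)) ∙ Φ (suc k)  ≈⟨ ∙-congˡ (sym Φ-j) ⟩
      (Φ k ⁻¹ ∙ ψ Γ (L.vertex i) (L.vertex j)) ∙ Φ (toℕ j)  ∎
      where
      k = toℕ i
      pos-k : pos k ≡ i
      pos-k = pos-toℕ i
      pos-1+k : pos (suc k) ≡ j
      pos-1+k = FP.toℕ-injective (≡.trans (toℕ-pos (suc k)) (≡.sym j-next))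
      Φ-j : Φ (toℕ j) ≈ Φ (suc k)
      Φ-j with suc k ℕP.<? N
      ... | yes 1+k<N = reflexive (≡.cong Φ (≡.trans j-next (%N-id 1+k<N)))
      ... | no 1+k≮N = trans (reflexive (≡.cong Φ (≡.trans j-next (≡.trans (≡.cong (ℕ._% N) 1+k≡N) (n%n≡0 N)))))
                             (trans (sym Φ-N) (reflexive (≡.cong Φ (≡.sym 1+k≡N))))
        where
        1+k≡N : suc k ≡ N
        1+k≡N = ℕP.≤-antisym (FP.toℕ<n i) (ℕP.≮⇒≥ 1+k≮N)

    cycle-edge : ∀ i j → cycleAdj N i j ≡ true →
      ψ Γ′ (L′.vertex i) (L′.vertex j) ≈ (Φ (toℕ i) ⁻¹ ∙ ψ Γ (L.vertex i) (L.vertex j)) ∙ Φ (toℕ j)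
    cycle-edge i j ij with cycleAdj-elim i j ij
    ... | inj₁ j-next = forward-edge i j j-next
    ... | inj₂ i-next = begin
      ψ Γ′ (L′.vertex i) (L′.vertex j)                                  ≈⟨ ψ-inv Γ′ (L′.vertex j) (L′.vertex i) (≡.trans (L′.adj-vertex j i) ji) ⟩
      ψ Γ′ (L′.vertex j) (L′.vertex i) ⁻¹                               ≈⟨ ⁻¹-cong (forward-edge j i i-next) ⟩
      ((Φ (toℕ j) ⁻¹ ∙ ψ Γ (L.vertex j) (L.vertex i)) ∙ Φ (toℕ i)) ⁻¹  ≈⟨ ⁻¹-cong (∙-congʳ (∙-congˡ (ψ-inv Γ (L.vertex i) (L.vertex j) (≡.trans (L.adj-vertex i j) ij)))) ⟩
      ((Φ (toℕ j) ⁻¹ ∙ ψ Γ (L.vertex i) (L.vertex j) ⁻¹) ∙ Φ (toℕ i)) ⁻¹  ≈⟨ reverse _ _ _ ⟩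
      (Φ (toℕ i) ⁻¹ ∙ ψ Γ (L.vertex i) (L.vertex j)) ∙ Φ (toℕ j)      ∎
      where
      ji : cycleAdj N j i ≡ true
      ji = cycleAdj-next j i i-next
      reverse : ∀ a b s → ((b ⁻¹ ∙ s ⁻¹) ∙ a) ⁻¹ ≈ (a ⁻¹ ∙ s) ∙ b
      reverse a b s = begin
        ((b ⁻¹ ∙ s ⁻¹) ∙ a) ⁻¹     ≈⟨ ⁻¹-anti-homo-∙ _ _ ⟩
        a ⁻¹ ∙ (b ⁻¹ ∙ s ⁻¹) ⁻¹    ≈⟨ ∙-congˡ (⁻¹-anti-homo-∙ _ _) ⟩
        a ⁻¹ ∙ (s ⁻¹ ⁻¹ ∙ b ⁻¹ ⁻¹) ≈⟨ ∙-congˡ (∙-cong (⁻¹-involutive s) (⁻¹-involutive b)) ⟩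
        a ⁻¹ ∙ (s ∙ b)             ≈⟨ sym (assoc _ _ _) ⟩
        (a ⁻¹ ∙ s) ∙ b             ∎

    switches : ∀ u v → adj Γ u v ≡ true → ψ Γ′ (φ u) (φ v) ≈ (f u ⁻¹ ∙ ψ Γ u v) ∙ f v
    switches u v uv = begin
      ψ Γ′ (φ u) (φ v)
        ≈⟨ cycle-edge (L.position u) (L.position v) (≡.trans (≡.sym (L.adj-vertex _ _)) (≡.trans (≡.cong₂ (adj Γ) (L.vertex-position u) (L.vertex-position v)) uv)) ⟩
      (f u ⁻¹ ∙ ψ Γ (L.vertex (L.position u)) (L.vertex (L.position v))) ∙ f v
        ≡⟨ ≡.cong₂ (λ x y → (f u ⁻¹ ∙ ψ Γ x y) ∙ f v) (L.vertex-position u) (L.vertex-position v) ⟩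
      (f u ⁻¹ ∙ ψ Γ u v) ∙ f v ∎

  conjugate-cycleGains⇒switchingIsomorphic : ∀ {Γ Γ′ : GainGraph G N} (L : CycleLabelling (adj Γ)) (L′ : CycleLabelling (adj Γ′)) →
    Along.cycleGain Γ L ∼ Along.cycleGain Γ′ L′ → SwitchingIsomorphic G Γ Γ′
  conjugate-cycleGains⇒switchingIsomorphic L L′ (t , tgt⁻¹≈g′) = labellings⇒GraphIso L L′ , f , switches
    where open Switching L L′ t tgt⁻¹≈g′

module Cospectrality {c ℓ : Level} (G : Group c ℓ) where

  open import Data.List.Relation.Unary.Any as Any using ()
  open import Data.List.Membership.Propositional using (_∈_; find)
  open import Data.List.Relation.Binary.Permutation.Homogeneous using (Permutation; onIndices)
  import Data.List.Relation.Binary.Permutation.Homogeneous as Perm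
  open import Data.Fin.Permutation using (↔⇒≡)
  open import Data.Sum using (_⊎_; inj₁; inj₂)
  open import Data.Product using (_×_; _,_; ∃)
  open import Function using (flip)
  open Group G renaming (Carrier to Elt)
  open import Algebra.Properties.Group G using (ε⁻¹≈ε)
  open Conjugacy G
  open import Data.List.Relation.Binary.Permutation.Setoid.Properties conjugacy using (Any-resp-↭)
  open WalkCounts using (closedWalks; length-trace)

  ↭-transfer : ∀ {xs ys} → Permutation _∼_ xs ys → ∀ {x} → x ∈ xs → ∃ λ y → y ∈ ys × x ∼ y
  ↭-transfer xs↭ys {x} x∈ = find (Any-resp-↭ (flip ∼-trans) xs↭ys (Any.map (λ { ≡.refl → ∼-refl }) x∈))

  cospectral⇒closedWalks : ∀ {n} (Γ Γ′ : GainGraph G n) → Cospectral G Γ Γ′ → ∀ h → closedWalks (adj Γ) h ≡ closedWalks (adj Γ′) h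
  cospectral⇒closedWalks Γ Γ′ cospectral h =
    ≡.trans (≡.sym (length-trace G Γ h)) (≡.trans (↔⇒≡ (onIndices (cospectral h))) (length-trace G Γ′ h))

  cospectral-to-cycle⇒HasCycleWalkCounts : ∀ m {Γ Γ′ : GainGraph G (3 + m)} → CycleLabellings.CycleLabelling m (adj Γ) →
    Cospectral G Γ Γ′ → DegreeTwo.HasCycleWalkCounts (3 + m) (adj Γ′)
  cospectral-to-cycle⇒HasCycleWalkCounts m {Γ} {Γ′} L cospectral h h<N =
    ≡.trans (≡.sym (cospectral⇒closedWalks Γ Γ′ cospectral h)) (CycleLabellings.Labelled.closedWalks-cycle m L h h<N)

  module _ (m : ℕ) {Γ Γ′ : GainGraph G (3 + m)}
    (L : CycleLabellings.CycleLabelling m (adj Γ)) (L′ : CycleLabellings.CycleLabelling m (adj Γ′)) where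
    open CycleGains G m
    open CycleArithmetic m using (N)
    open Along Γ L using (cycleGain; trace-gain-classes; cycleGain∈trace)
    open Along Γ′ L′ using () renaming (cycleGain to cycleGain′; trace-gain-classes to trace-gain-classes′; cycleGain∈trace to cycleGain′∈trace)

    -- g′ occurs in tr A′ᴺ, so it is conjugate to ε, g or g⁻¹ by the classification
    -- for Γ; in the first case every class in tr A′ᴺ is trivial, and g as well.
    cospectral⇒cycleGain-conjugate : Permutation _∼_ (Tr G (Along.Aʰ Γ L N)) (Tr G (Along.Aʰ Γ′ L′ N)) →
      cycleGain ∼ cycleGain′ ⊎ cycleGain ⁻¹ ∼ cycleGain′
    cospectral⇒cycleGain-conjugate trN =
      let y , y∈ , y≈g′ = cycleGain′∈trace
          x , x∈ , y∼x  = ↭-transfer (Perm.sym ∼-sym trN) y∈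
      in classify (∼-respʳ-≈ (∼-sym y∼x) y≈g′) (trace-gain-classes x x∈)
      where
      g∼g′-if-trivial : cycleGain′ ∼ ε → cycleGain ∼ cycleGain′
      g∼g′-if-trivial g′∼ε =
        let z , z∈ , z≈g = cycleGain∈trace
            w , w∈ , z∼w = ↭-transfer trN z∈
        in ∼-trans (∼-respˡ-≈ (sym z≈g) z∼w) (to-g′ (trace-gain-classes′ w w∈))
        where
        to-g′ : ∀ {w} → w ∼ ε ⊎ w ∼ cycleGain′ ⊎ w ∼ cycleGain′ ⁻¹ → w ∼ cycleGain′
        to-g′ (inj₁ w∼ε)           = ∼-trans w∼ε (∼-sym g′∼ε)
        to-g′ (inj₂ (inj₁ w∼g′))   = w∼g′
        to-g′ (inj₂ (inj₂ w∼g′⁻¹)) = ∼-trans w∼g′⁻¹ (∼-trans (∼-respʳ-≈ (∼-⁻¹ g′∼ε) ε⁻¹≈ε) (∼-sym g′∼ε))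
      classify : ∀ {x} → x ∼ cycleGain′ → x ∼ ε ⊎ x ∼ cycleGain ⊎ x ∼ cycleGain ⁻¹ →
        cycleGain ∼ cycleGain′ ⊎ cycleGain ⁻¹ ∼ cycleGain′
      classify x∼g′ (inj₁ x∼ε)          = inj₁ (g∼g′-if-trivial (∼-trans (∼-sym x∼g′) x∼ε))
      classify x∼g′ (inj₂ (inj₁ x∼g))   = inj₁ (∼-trans (∼-sym x∼g) x∼g′)
      classify x∼g′ (inj₂ (inj₂ x∼g⁻¹)) = inj₂ (∼-trans (∼-sym x∼g⁻¹) x∼g′)

corollary5p2 : {c ℓ : Level} (G : Group c ℓ) (m : ℕ) (Γ Γ′ : GainGraph G (3 + m))
    → GraphIso (adj Γ) (cycleAdj (3 + m))
    → Cospectral G Γ Γ′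
    → SwitchingIsomorphic G Γ Γ′
corollary5p2 G m Γ Γ′ iso cospectral = switch (cospectral⇒cycleGain-conjugate m L labelling₁ (cospectral (3 + m)))
  where
  open Group G using (_⁻¹; sym)
  open Conjugacy G
  open Cospectrality G
  open CycleGains G m
  L = CycleLabellings.labelling-from-iso m iso
  open CycleFromWalkCounts m (simple Γ′) (cospectral-to-cycle⇒HasCycleWalkCounts m {Γ} {Γ′} L cospectral)
    using (labelling₁; labelling₂; orientations-reversed)
  g = Along.cycleGain Γ L
  switch : g ∼ Along.cycleGain Γ′ labelling₁ ⊎ g ⁻¹ ∼ Along.cycleGain Γ′ labelling₁ → SwitchingIsomorphic G Γ Γ′
  switch (inj₁ g∼g₁)   = conjugate-cycleGains⇒switchingIsomorphic L labelling₁ g∼g₁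
  switch (inj₂ g⁻¹∼g₁) = conjugate-cycleGains⇒switchingIsomorphic L labelling₂
    (∼-respʳ-≈ (⁻¹∼⇒∼⁻¹ g⁻¹∼g₁) (sym (reversed-cycleGain labelling₁ labelling₂ orientations-reversed)))
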